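{- Let $n\geq 2$, let $M_0$ be a simple matroid on a ground set $E_0$ disjoint from $[n]$, fix $\epsilon_0\in E_0$, and let $M=C_n\oplus M_0$ and $M'=P^n_{\epsilon_0}\oplus S$. Then $$T_M(x,y)=\Bigl(\sum_{i=1}^{n-1}x^i+y\Bigr)T_{M_0}(x,y)$$ and $$T_{M'}(x,y)=\Bigl(\sum_{i=1}^{n-1}x^i\Bigr)T_{M_0}(x,y)+xy\,T_{M_0/\epsilon_0}(x,y).$$
   Context: $T_N(x,y)$ is the Tutte polynomial of a matroid $N$, and $M_0/\epsilon_0$ is the contraction of $M_0$ by $\epsilon_0$. $C_n$ is the matroid on $[n]=\{1,\dots,n\}$ of rank $n-1$ whose only circuit is $[n]$; $S$ is the rank-one matroid on a single point $p$; $\oplus$ is direct sum. The parallel connection $P^n_{\epsilon_0}$: on $[n]\cup E_0$ identify $1$ with $\epsilon_0$ (other classes singletons), write $\bar q$ for the class of $q$, $\bar X$ for the set of classes of elements of $X$, $\bar E$ for the set of classes; $P^n_{\epsilon_0}$ is the matroid on $\bar E$ whose circuits are the $\bar C$ with $C$ a circuit of $C_n$ or of $M_0$, together with the sets $\overline{C-1}\cup\overline{C'-\epsilon_0}$ with $1\in C$ a circuit of $C_n$ and $\epsilon_0\in C'$ a circuit of $M_0$. -}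

module Defs where

open import Data.Bool using (Bool; true; false; _∧_; _∨_; not; if_then_else_)
open import Data.Nat using (ℕ; zero; suc; _+_; _∸_; _≤_; _⊔_)
open import Data.Fin using (Fin; zero; suc; punchIn)
open import Data.Fin.Subset using (Subset; inside; outside; _∈_; _⊆_; _∩_; _∪_; _─_; ⁅_⁆; ∣_∣; ⊥; ⊤)
open import Data.Vec using (Vec; []; _∷_; _++_; take; drop; tabulate; lookup; zipWith; foldr)
open import Data.List using (List; []; _∷_; map; concatMap; applyUpTo)
open import Data.Bool.ListAction using (any; all)
open import Data.Integer using (ℤ; +_; _-_; _^_) renaming (_+_ to _+ℤ_; _*_ to _*ℤ_)
open import Data.Product using (_×_; _,_; proj₁; proj₂; ∃)
open import Relation.Binary.PropositionalEquality using (_≡_; _≢_)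
open import Relation.Nullary using (¬_)

allSubsets : (k : ℕ) → List (Subset k)
allSubsets zero    = [] ∷ []
allSubsets (suc k) = concatMap (λ s → (outside ∷ s) ∷ (inside ∷ s) ∷ []) (allSubsets k)

_⊆ᵇ_ : ∀ {k} → Subset k → Subset k → Bool
[]      ⊆ᵇ []      = true
(a ∷ s) ⊆ᵇ (b ∷ t) = (not a ∨ b) ∧ (s ⊆ᵇ t)

_≡ᵇ_ : ∀ {k} → Subset k → Subset k → Bool
s ≡ᵇ t = (s ⊆ᵇ t) ∧ (t ⊆ᵇ s)

isEmptyᵇ : ∀ {k} → Subset k → Bool
isEmptyᵇ s = s ⊆ᵇ ⊥

subsetsOf : ∀ {k} → Subset k → List (Subset k)
subsetsOf {k} A = Data.List.filterᵇ (λ I → I ⊆ᵇ A) (allSubsets k)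
  where import Data.List

record Matroid (k : ℕ) : Set where
  field
    circ : Subset k → Bool

IsCircuit : ∀ {k} → Matroid k → Subset k → Set
IsCircuit M C = Matroid.circ M C ≡ true

record IsMatroid {k : ℕ} (M : Matroid k) : Set where
  field
    C1 : ¬ IsCircuit M ⊥
    C2 : ∀ C D → IsCircuit M C → IsCircuit M D → C ⊆ D → C ≡ D
    C3 : ∀ C D e → IsCircuit M C → IsCircuit M D → C ≢ D → e ∈ C → e ∈ D →
         ∃ λ F → IsCircuit M F × F ⊆ ((C ∪ D) ─ ⁅ e ⁆)

-- simple: no loops and no parallel pairs, i.e. every circuit has ≥ 3 elements
Simple : ∀ {k} → Matroid k → Set
Simple M = ∀ C → IsCircuit M C → 3 ≤ ∣ C ∣

independentᵇ : ∀ {k} → Matroid k → Subset k → Bool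
independentᵇ M I = not (any (Matroid.circ M) (subsetsOf I))

rank : ∀ {k} → Matroid k → Subset k → ℕ
rank M A = Data.List.foldr (λ I r → if independentᵇ M I then ∣ I ∣ ⊔ r else r) 0 (subsetsOf A)
  where import Data.List

sumℤ : List ℤ → ℤ
sumℤ = Data.List.foldr _+ℤ_ (+ 0)
  where import Data.List

Tutte : ∀ {k} → Matroid k → ℤ → ℤ → ℤ
Tutte {k} M x y =
  sumℤ (map (λ A → ((x - + 1) ^ (rank M ⊤ ∸ rank M A)) *ℤ ((y - + 1) ^ (∣ A ∣ ∸ rank M A)))
            (allSubsets k))

Cyc : (n : ℕ) → Matroid n
Cyc n = record { circ = λ X → X ≡ᵇ ⊤ }

Spt : Matroid 1
Spt = record { circ = λ _ → false }

_⊕_ : ∀ {a b} → Matroid a → Matroid b → Matroid (a + b)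
_⊕_ {a} {b} M N = record { circ = λ X → go (take a X , drop a X) }
  where
  go : Subset a × Subset b → Bool
  go (Y , Z) = (Matroid.circ M Y ∧ isEmptyᵇ Z) ∨ (isEmptyᵇ Y ∧ Matroid.circ N Z)

dropPt : ∀ {m} → Fin (suc m) → Subset (suc m) → Subset m
dropPt p X = tabulate (λ i → lookup X (punchIn p i))

contract : ∀ {m} → Matroid (suc m) → Fin (suc m) → Matroid m
contract {m} M e = record { circ = λ X → D X ∧ all (λ Y → not (D Y) ∨ (Y ≡ᵇ X)) (subsetsOf X) }
  where
  D : Subset m → Bool
  D X = not (isEmptyᵇ X) ∧ any (λ C → Matroid.circ M C ∧ (dropPt e C ≡ᵇ X)) (allSubsets (suc m))

-- parallel connection of N (ground set Fin (suc a), basepoint p) and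
-- M (ground set Fin (suc b), basepoint q), identifying p with q.
-- Ground set of the result: Fin (a + suc b); the first a elements are the
-- classes of the elements of N other than p, the remaining suc b are the
-- classes of the elements of M (the class of q being {p , q}).
parallel : ∀ {a b} → Matroid (suc a) → Fin (suc a) → Matroid (suc b) → Fin (suc b) →
           Matroid (a + suc b)
parallel {a} {b} N p M q = record { circ = λ X → go (take a X , drop a X) }
  where
  imgN : Subset (suc a) → Subset a × Subset (suc b)
  imgN C = dropPt p C , (if lookup C p then ⁅ q ⁆ else ⊥)
  eqP : Subset a × Subset (suc b) → Subset a × Subset (suc b) → Bool
  eqP (Y , Z) (Y' , Z') = (Y ≡ᵇ Y') ∧ (Z ≡ᵇ Z')
  go : Subset a × Subset (suc b) → Bool
  go YZ =
       any (λ C → Matroid.circ N C ∧ eqP (imgN C) YZ) (allSubsets (suc a))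
    ∨  any (λ C' → Matroid.circ M C' ∧ eqP (⊥ , C') YZ) (allSubsets (suc b))
    ∨  any (λ C → Matroid.circ N C ∧ lookup C p ∧
          any (λ C' → Matroid.circ M C' ∧ lookup C' q ∧
                 eqP (dropPt p C , (C' ─ ⁅ q ⁆)) YZ)
              (allSubsets (suc b)))
          (allSubsets (suc a))

sumPow : ℤ → ℕ → ℤ
sumPow x j = sumℤ (map (λ i → x ^ i) (applyUpTo suc j))

{-# OPTIONS --safe #-}

-- Both matroids are direct sums, and the Tutte polynomial is multiplicative on direct sums because the
-- rank is additive on the two blocks of coordinates. Every proper subset of [n] is independent in C_n, and
-- summing (x − 1)^(n − 1 − |A|) over the proper subsets A of [n] gives 1 + x + ⋯ + x^(n−1); so
-- T(C_n) = x + ⋯ + x^(n−1) + y.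
-- In the parallel connection P, write a set as F ∪ B with F ⊆ {2, …, n} and B ⊆ E₀. Every circuit of P
-- meeting {2, …, n} contains all of it, so if F misses an element then r(F ∪ B) = |F| + r₀(B). If F
-- is everything, the cycle closes through ε₀ and r(F ∪ B) = n − 2 + r₀(B ∪ ε₀) = n − 1 + r_{M₀/ε₀}(B − ε₀);
-- here only ε₀ not being a loop is needed, so that some basis of B ∪ ε₀ contains ε₀. Summing over F gives
-- T(P) = (1 + x + ⋯ + x^(n−2)) T_{M₀} + y T_{M₀/ε₀}, and T(S) = x.
module Submission where

open import Defs
open import Data.Nat using (ℕ; suc; _+_)
open import Data.Fin using (Fin; zero)
open import Data.Integer using (ℤ) renaming (_+_ to _+ℤ_; _*_ to _*ℤ_)
open import Data.Product using (_×_)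
open import Relation.Binary.PropositionalEquality using (_≡_)

open import Data.Bool using (Bool; true; false; _∧_; _∨_; not; if_then_else_)
open import Data.Bool.Properties
  using (T-≡; ¬-not; ∨-zeroʳ; ∨-identityʳ; ∧-conicalˡ; ∧-conicalʳ; ∨-conicalˡ; ∨-conicalʳ)
open import Data.Bool.ListAction using (any; all)
open import Data.Empty using (⊥-elim)
open import Data.Nat using (zero; _∸_; _≤_; _<_; _⊔_; z≤n; s≤s)
import Data.Nat.Properties as ℕₚ
open import Data.Integer using (+_; _-_; _^_)
import Data.Integer.Properties as ℤₚ
open import Data.Integer.Tactic.RingSolver using (solve-∀)
open import Data.Fin using (suc; _≟_)
open import Data.Fin.Properties using (any?)
open import Data.Fin.Subset using (Subset; inside; outside; ⊤; ⁅_⁆; _∪_; _─_; ∣_∣; _∈_; _∉_; _⊆_)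
  renaming (⊥ to ∅)
open import Data.Fin.Subset.Properties
open import Data.Vec using (Vec; []; _∷_; here; there; _++_; take; drop; splitAt; insertAt; lookup)
import Data.Vec.Properties as Vecₚ
open import Data.Vec.Properties using (∷-injectiveʳ)
open import Data.List using (List; []; _∷_; map; foldr; concatMap; applyUpTo)
open import Data.List.Membership.Propositional using (find; lose) renaming (_∈_ to _∈ₗ_)
open import Data.List.Membership.Propositional.Properties using (∈-filter⁺; ∈-filter⁻; ∈-concat⁺′; ∈-map⁺)
import Data.List.Relation.Unary.Any as Any
open import Data.List.Relation.Unary.Any.Properties using (any⁺; any⁻)
open import Data.Product using (∃; _,_; proj₁; proj₂)
open import Data.Sum using (_⊎_; inj₁; inj₂)
import Data.Sum
open import Function.Bundles using (Equivalence)
open import Function using (_∘_; id)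
open import Relation.Binary.PropositionalEquality
  using (_≢_; refl; sym; trans; cong; cong₂; subst; subst₂; module ≡-Reasoning)
open import Relation.Nullary using (¬_; T?; yes; no; ¬?; _×-dec_)

∧-true⁻ : ∀ {a b} → a ∧ b ≡ true → a ≡ true × b ≡ true
∧-true⁻ {a} {b} h = ∧-conicalˡ a b h , ∧-conicalʳ a b h

∧-true⁺ : ∀ {a b} → a ≡ true → b ≡ true → a ∧ b ≡ true
∧-true⁺ refl refl = refl

∨-true⁻ : ∀ {a b} → a ∨ b ≡ true → a ≡ true ⊎ b ≡ true
∨-true⁻ {true}  _      = inj₁ refl
∨-true⁻ {false} b≡true = inj₂ b≡true

∨-true⁺ˡ : ∀ {a} b → a ≡ true → a ∨ b ≡ true
∨-true⁺ˡ b refl = refl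

∨-true⁺ʳ : ∀ a {b} → b ≡ true → a ∨ b ≡ true
∨-true⁺ʳ a refl = ∨-zeroʳ a

∨-false⁻ : ∀ {a b} → a ∨ b ≡ false → a ≡ false × b ≡ false
∨-false⁻ {a} {b} h = ∨-conicalˡ a b h , ∨-conicalʳ a b h

not-false⁻ : ∀ {a} → not a ≡ false → a ≡ true
not-false⁻ {true} _ = refl

true≢false : true ≢ false
true≢false ()

⊆ᵇ⇒⊆ : ∀ {n} {p q : Subset n} → (p ⊆ᵇ q) ≡ true → p ⊆ q
⊆ᵇ⇒⊆ {p = inside ∷ p} {inside ∷ q} _ here      = here
⊆ᵇ⇒⊆ {p = a ∷ p}      {b ∷ q}      h (there x) = there (⊆ᵇ⇒⊆ (proj₂ (∧-true⁻ {not a ∨ b} h)) x)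

⊆⇒⊆ᵇ : ∀ {n} {p q : Subset n} → p ⊆ q → (p ⊆ᵇ q) ≡ true
⊆⇒⊆ᵇ {p = []}           {[]}    _   = refl
⊆⇒⊆ᵇ {p = outside ∷ p} {b ∷ q} p⊆q = ⊆⇒⊆ᵇ (drop-∷-⊆ p⊆q)
⊆⇒⊆ᵇ {p = inside ∷ p}  {b ∷ q} p⊆q with p⊆q here
... | here = ⊆⇒⊆ᵇ (drop-∷-⊆ p⊆q)

≡ᵇ⇒≡ : ∀ {n} {p q : Subset n} → (p ≡ᵇ q) ≡ true → p ≡ q
≡ᵇ⇒≡ {p = p} {q} h = let p⊆q , q⊆p = ∧-true⁻ {p ⊆ᵇ q} h in ⊆-antisym (⊆ᵇ⇒⊆ p⊆q) (⊆ᵇ⇒⊆ q⊆p)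

≡⇒≡ᵇ : ∀ {n} {p q : Subset n} → p ≡ q → (p ≡ᵇ q) ≡ true
≡⇒≡ᵇ {p = p} refl = ∧-true⁺ (⊆⇒⊆ᵇ {p = p} ⊆-refl) (⊆⇒⊆ᵇ {p = p} ⊆-refl)

isEmptyᵇ⇒≡∅ : ∀ {n} {p : Subset n} → isEmptyᵇ p ≡ true → p ≡ ∅
isEmptyᵇ⇒≡∅ h = ⊆-antisym (⊆ᵇ⇒⊆ h) ⊥⊆

isEmptyᵇ-∅ : ∀ {n} → isEmptyᵇ (∅ {n}) ≡ true
isEmptyᵇ-∅ {n} = ⊆⇒⊆ᵇ {p = ∅ {n}} ⊆-refl

∈-allSubsets : ∀ {k} (s : Subset k) → s ∈ₗ allSubsets k
∈-allSubsets []                = Any.here refl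
∈-allSubsets (outside ∷ s) = ∈-concat⁺′ (Any.here refl) (∈-map⁺ _ (∈-allSubsets s))
∈-allSubsets (inside ∷ s)  = ∈-concat⁺′ (Any.there (Any.here refl)) (∈-map⁺ _ (∈-allSubsets s))

∈-subsetsOf⁺ : ∀ {k} {I J : Subset k} → J ⊆ I → J ∈ₗ subsetsOf I
∈-subsetsOf⁺ {I = I} {J} J⊆I = ∈-filter⁺ (T? ∘ (_⊆ᵇ I)) (∈-allSubsets J) (Equivalence.from T-≡ (⊆⇒⊆ᵇ J⊆I))

∈-subsetsOf⁻ : ∀ {k} {I J : Subset k} → J ∈ₗ subsetsOf I → J ⊆ I
∈-subsetsOf⁻ {k} {I} J∈ = ⊆ᵇ⇒⊆ (Equivalence.to T-≡ (proj₂ (∈-filter⁻ (T? ∘ (_⊆ᵇ I)) {xs = allSubsets k} J∈)))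

any-true⁻ : ∀ {A : Set} (p : A → Bool) xs → any p xs ≡ true → ∃ λ x → x ∈ₗ xs × p x ≡ true
any-true⁻ p xs h =
  let x , x∈xs , px = find (any⁻ p xs (Equivalence.from T-≡ h)) in x , x∈xs , Equivalence.to T-≡ px

any-true⁺ : ∀ {A : Set} (p : A → Bool) {xs x} → x ∈ₗ xs → p x ≡ true → any p xs ≡ true
any-true⁺ p x∈xs px = Equivalence.to T-≡ (any⁺ p (lose x∈xs (Equivalence.from T-≡ px)))

all-false⁻ : ∀ {A : Set} (p : A → Bool) xs → all p xs ≡ false → ∃ λ x → x ∈ₗ xs × p x ≡ false
all-false⁻ p (x ∷ xs) h with p x in px
... | false = x , Any.here refl , px
... | true  = let y , y∈xs , py = all-false⁻ p xs h in y , Any.there y∈xs , py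

x∈p─q⇒x∉q : ∀ {n} {p q : Subset n} {x} → x ∈ p ─ q → x ∉ q
x∈p─q⇒x∉q {p = inside ∷ p} {outside ∷ q} here        ()
x∈p─q⇒x∉q {p = _ ∷ p}      {_ ∷ q}       (there x∈) (there x∈q) = x∈p─q⇒x∉q x∈ x∈q

x∈p─⁅y⁆⁻ : ∀ {n} {p : Subset n} {x y} → x ∈ p ─ ⁅ y ⁆ → x ∈ p × x ≢ y
x∈p─⁅y⁆⁻ {p = p} {y = y} x∈ = p─q⊆p p ⁅ y ⁆ x∈ , x∉⁅y⁆⇒x≢y (x∈p─q⇒x∉q x∈)

x∈p∪⁅y⁆⁻ : ∀ {n} {p : Subset n} {x y} → x ∈ p ∪ ⁅ y ⁆ → x ∈ p ⊎ x ≡ y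
x∈p∪⁅y⁆⁻ {p = p} {y = y} x∈ = Data.Sum.map₂ (x∈⁅y⁆⇒x≡y y) (x∈p∪q⁻ p ⁅ y ⁆ x∈)

x∈p∪⁅x⁆ : ∀ {n} (p : Subset n) x → x ∈ p ∪ ⁅ x ⁆
x∈p∪⁅x⁆ p x = x∈p∪q⁺ (inj₂ (x∈⁅x⁆ x))

p⊆q∪⁅x⁆⇒p─⁅x⁆⊆q : ∀ {n} {p q : Subset n} {x} → p ⊆ q ∪ ⁅ x ⁆ → p ─ ⁅ x ⁆ ⊆ q
p⊆q∪⁅x⁆⇒p─⁅x⁆⊆q p⊆ y∈ with x∈p─⁅y⁆⁻ y∈
... | y∈p , y≢x = Data.Sum.[ id , ⊥-elim ∘ y≢x ] (x∈p∪⁅y⁆⁻ (p⊆ y∈p))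

p⊆q⇒p∪⁅x⁆⊆q∪⁅x⁆ : ∀ {n} {p q : Subset n} {x} → p ⊆ q → p ∪ ⁅ x ⁆ ⊆ q ∪ ⁅ x ⁆
p⊆q⇒p∪⁅x⁆⊆q∪⁅x⁆ {q = q} {x} p⊆q y∈ = Data.Sum.[ p⊆p∪q _ ∘ p⊆q , (λ { refl → x∈p∪⁅x⁆ q x }) ] (x∈p∪⁅y⁆⁻ y∈)

p─⁅x⁆⊆q⇒p⊆q∪⁅x⁆ : ∀ {n} {p q : Subset n} {x} → p ─ ⁅ x ⁆ ⊆ q → p ⊆ q ∪ ⁅ x ⁆
p─⁅x⁆⊆q⇒p⊆q∪⁅x⁆ {q = q} {x} p─x⊆q {y} y∈p with y ≟ x
... | yes refl = x∈p∪⁅x⁆ q x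
... | no  y≢x  = p⊆p∪q ⁅ x ⁆ (p─x⊆q (x∈p∧x≢y⇒x∈p-y y∈p y≢x))

x∉p⇒p⊆q∪⁅x⁆⇒p⊆q : ∀ {n} {p q : Subset n} {x} → x ∉ p → p ⊆ q ∪ ⁅ x ⁆ → p ⊆ q
x∉p⇒p⊆q∪⁅x⁆⇒p⊆q x∉p p⊆ y∈p = Data.Sum.[ id , (λ { refl → ⊥-elim (x∉p y∈p) }) ] (x∈p∪⁅y⁆⁻ (p⊆ y∈p))

∣p∪⁅x⁆∣≡1+∣p∣ : ∀ {n} {p : Subset n} {x} → x ∉ p → ∣ p ∪ ⁅ x ⁆ ∣ ≡ suc ∣ p ∣
∣p∪⁅x⁆∣≡1+∣p∣ {p = outside ∷ p} {zero}  _   = cong (suc ∘ ∣_∣) (∪-identityʳ p)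
∣p∪⁅x⁆∣≡1+∣p∣ {p = inside ∷ p}  {zero}  x∉p = ⊥-elim (x∉p here)
∣p∪⁅x⁆∣≡1+∣p∣ {p = outside ∷ p} {suc x} x∉p = ∣p∪⁅x⁆∣≡1+∣p∣ (x∉p ∘ there)
∣p∪⁅x⁆∣≡1+∣p∣ {p = inside ∷ p}  {suc x} x∉p = cong suc (∣p∪⁅x⁆∣≡1+∣p∣ (x∉p ∘ there))

p─⁅x⁆∪⁅x⁆≡p : ∀ {n} {p : Subset n} {x} → x ∈ p → (p ─ ⁅ x ⁆) ∪ ⁅ x ⁆ ≡ p
p─⁅x⁆∪⁅x⁆≡p {p = p} {x} x∈p =
  ⊆-antisym (λ y∈ → Data.Sum.[ proj₁ ∘ x∈p─⁅y⁆⁻ , (λ { refl → x∈p }) ] (x∈p∪⁅y⁆⁻ y∈))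
            (p─⁅x⁆⊆q⇒p⊆q∪⁅x⁆ id)

1+∣p─⁅x⁆∣≡∣p∣ : ∀ {n} {p : Subset n} {x} → x ∈ p → suc ∣ p ─ ⁅ x ⁆ ∣ ≡ ∣ p ∣
1+∣p─⁅x⁆∣≡∣p∣ {p = p} {x} x∈p = begin
  suc ∣ p ─ ⁅ x ⁆ ∣         ≡⟨ ∣p∪⁅x⁆∣≡1+∣p∣ {p = p ─ ⁅ x ⁆} (λ x∈ → proj₂ (x∈p─⁅y⁆⁻ {p = p} x∈) refl) ⟨
  ∣ (p ─ ⁅ x ⁆) ∪ ⁅ x ⁆ ∣   ≡⟨ cong ∣_∣ (p─⁅x⁆∪⁅x⁆≡p x∈p) ⟩
  ∣ p ∣                     ∎
  where open ≡-Reasoning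

p⊆q∧p≢q⇒∣p∣<∣q∣ : ∀ {n} {p q : Subset n} → p ⊆ q → p ≢ q → ∣ p ∣ < ∣ q ∣
p⊆q∧p≢q⇒∣p∣<∣q∣ {p = []}          {[]}          _   p≢q = ⊥-elim (p≢q refl)
p⊆q∧p≢q⇒∣p∣<∣q∣ {p = outside ∷ p} {inside ∷ q}  p⊆q _   = s≤s (p⊆q⇒∣p∣≤∣q∣ (drop-∷-⊆ p⊆q))
p⊆q∧p≢q⇒∣p∣<∣q∣ {p = outside ∷ p} {outside ∷ q} p⊆q p≢q =
  p⊆q∧p≢q⇒∣p∣<∣q∣ (drop-∷-⊆ p⊆q) (p≢q ∘ cong (outside ∷_))
p⊆q∧p≢q⇒∣p∣<∣q∣ {p = inside ∷ p}  {inside ∷ q}  p⊆q p≢q =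
  s≤s (p⊆q∧p≢q⇒∣p∣<∣q∣ (drop-∷-⊆ p⊆q) (p≢q ∘ cong (inside ∷_)))
p⊆q∧p≢q⇒∣p∣<∣q∣ {p = inside ∷ p}  {outside ∷ q} p⊆q _ with p⊆q here
... | ()

p≢⊤⇒∣p∣<n : ∀ {n} {p : Subset n} → p ≢ ⊤ → ∣ p ∣ < n
p≢⊤⇒∣p∣<n {n} {p} p≢⊤ with ℕₚ.m≤n⇒m<n∨m≡n (∣p∣≤n p)
... | inj₁ ∣p∣<n = ∣p∣<n
... | inj₂ ∣p∣≡n = ⊥-elim (p≢⊤ (∣p∣≡n⇒p≡⊤ ∣p∣≡n))

insertAt-dropPt : ∀ {m} (i : Fin (suc m)) (C : Subset (suc m)) → insertAt (dropPt i C) i (lookup C i) ≡ C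
insertAt-dropPt         zero    (c ∷ C) = cong (c ∷_) (Vecₚ.tabulate∘lookup C)
insertAt-dropPt {suc m} (suc i) (c ∷ C) = cong (c ∷_) (insertAt-dropPt i C)

insertAt-⊤ : ∀ {m} (i : Fin (suc m)) → insertAt ⊤ i inside ≡ ⊤
insertAt-⊤         zero    = refl
insertAt-⊤ {suc m} (suc i) = cong (inside ∷_) (insertAt-⊤ i)

insertAt-∅ : ∀ {m} (i : Fin (suc m)) → insertAt ∅ i inside ≡ ⁅ i ⁆
insertAt-∅         zero    = refl
insertAt-∅ {suc m} (suc i) = cong (outside ∷_) (insertAt-∅ i)

insertAt-∪⁅⁆ : ∀ {m} (s : Subset m) i b → insertAt s i b ∪ ⁅ i ⁆ ≡ insertAt s i inside
insertAt-∪⁅⁆ s       zero    b = cong₂ _∷_ (∨-zeroʳ b) (∪-identityʳ s)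
insertAt-∪⁅⁆ (x ∷ s) (suc i) b = cong₂ _∷_ (∨-identityʳ x) (insertAt-∪⁅⁆ s i b)

∣insertAt-inside∣ : ∀ {m} (s : Subset m) i → ∣ insertAt s i inside ∣ ≡ suc ∣ s ∣
∣insertAt-inside∣ s             zero    = refl
∣insertAt-inside∣ (inside ∷ s)  (suc i) = cong suc (∣insertAt-inside∣ s i)
∣insertAt-inside∣ (outside ∷ s) (suc i) = ∣insertAt-inside∣ s i

∣insertAt-outside∣ : ∀ {m} (s : Subset m) i → ∣ insertAt s i outside ∣ ≡ ∣ s ∣
∣insertAt-outside∣ s             zero    = refl
∣insertAt-outside∣ (inside ∷ s)  (suc i) = cong suc (∣insertAt-outside∣ s i)
∣insertAt-outside∣ (outside ∷ s) (suc i) = ∣insertAt-outside∣ s i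

i∈insertAt-inside : ∀ {m} (s : Subset m) i → i ∈ insertAt s i inside
i∈insertAt-inside s i = Vecₚ.lookup⇒[]= i _ (Vecₚ.insertAt-lookup s i inside)

insertAt-⊆⁺ : ∀ {m} {s t : Subset m} i {b} → s ⊆ t → insertAt s i b ⊆ insertAt t i inside
insertAt-⊆⁺ zero s⊆t here = here
insertAt-⊆⁺ zero s⊆t (there x∈s) = there (s⊆t x∈s)
insertAt-⊆⁺ {s = inside ∷ s} {t ∷ ts} (suc i) s⊆t here with s⊆t here
... | here = here
insertAt-⊆⁺ {s = _ ∷ s} {t ∷ ts} (suc i) s⊆t (there x∈) = there (insertAt-⊆⁺ i (drop-∷-⊆ s⊆t) x∈)

insertAt-⊆⁻ : ∀ {m} {s t : Subset m} i {b c} → insertAt s i b ⊆ insertAt t i c → s ⊆ t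
insertAt-⊆⁻ zero ins⊆ x∈s = drop-there (ins⊆ (there x∈s))
insertAt-⊆⁻ {s = inside ∷ s} {t ∷ ts} (suc i) ins⊆ here with ins⊆ here
... | here = here
insertAt-⊆⁻ {s = _ ∷ s} {t ∷ ts} (suc i) ins⊆ (there x∈) = there (insertAt-⊆⁻ i (drop-∷-⊆ ins⊆) x∈)

⊆-insertAt⇒dropPt-⊆ : ∀ {m} {C : Subset (suc m)} {I} i {b} → C ⊆ insertAt I i b → dropPt i C ⊆ I
⊆-insertAt⇒dropPt-⊆ {C = C} i C⊆ = insertAt-⊆⁻ i (subst (_⊆ _) (sym (insertAt-dropPt i C)) C⊆)

dropPt-⊆⇒⊆-insertAt : ∀ {m} {C : Subset (suc m)} {I} i → dropPt i C ⊆ I → C ⊆ insertAt I i inside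
dropPt-⊆⇒⊆-insertAt {C = C} i dropC⊆I = subst (_⊆ _) (insertAt-dropPt i C) (insertAt-⊆⁺ i dropC⊆I)

module _ {A : Set} {a b} (xs : Vec A a) (ys : Vec A b) where

  take-++ : take a (xs ++ ys) ≡ xs
  take-++ = proj₁ (Vecₚ.++-injective _ xs (Vecₚ.take++drop≡id a (xs ++ ys)))

  drop-++ : drop a (xs ++ ys) ≡ ys
  drop-++ = proj₂ (Vecₚ.++-injective _ xs (Vecₚ.take++drop≡id a (xs ++ ys)))

⊤-++ : ∀ a {b} → ⊤ {a + b} ≡ ⊤ {a} ++ ⊤ {b}
⊤-++ zero    = refl
⊤-++ (suc a) = cong (inside ∷_) (⊤-++ a)

∅-++ : ∀ a {b} → ∅ {a + b} ≡ ∅ {a} ++ ∅ {b}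
∅-++ zero    = refl
∅-++ (suc a) = cong (outside ∷_) (∅-++ a)

∣++∣ : ∀ {a b} (Y : Subset a) (Z : Subset b) → ∣ Y ++ Z ∣ ≡ ∣ Y ∣ + ∣ Z ∣
∣++∣ []            Z = refl
∣++∣ (inside ∷ Y)  Z = cong suc (∣++∣ Y Z)
∣++∣ (outside ∷ Y) Z = ∣++∣ Y Z

++-⊆⁺ : ∀ {a b} {C Y : Subset a} {D Z : Subset b} → C ⊆ Y → D ⊆ Z → C ++ D ⊆ Y ++ Z
++-⊆⁺ {C = []}         {[]}    _   D⊆Z x∈D = D⊆Z x∈D
++-⊆⁺ {C = inside ∷ C} {y ∷ Y} C⊆Y D⊆Z here with C⊆Y here
... | here = here
++-⊆⁺ {C = _ ∷ C}      {_ ∷ Y} C⊆Y D⊆Z (there x∈) = there (++-⊆⁺ (drop-∷-⊆ C⊆Y) D⊆Z x∈)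

++-⊆⁻ : ∀ {a b} {C Y : Subset a} {D Z : Subset b} → C ++ D ⊆ Y ++ Z → C ⊆ Y × D ⊆ Z
++-⊆⁻ {C = []}    {[]}    h = (λ ()) , h
++-⊆⁻ {C = c ∷ C} {y ∷ Y} {D} {Z} h =
  let C⊆Y , D⊆Z = ++-⊆⁻ {C = C} {Y} {D} {Z} (drop-∷-⊆ h)
  in (λ { here → head (h here) ; (there x∈C) → there (C⊆Y x∈C) }) , D⊆Z
  where
  head : zero ∈ y ∷ (Y ++ Z) → zero ∈ y ∷ Y
  head here = here

-- Independence and rank

Independent : ∀ {k} → Matroid k → Subset k → Set
Independent M I = independentᵇ M I ≡ true

module _ {k} (M : Matroid k) where

  independent⁺ : ∀ {I} → (∀ C → C ⊆ I → ¬ IsCircuit M C) → Independent M I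
  independent⁺ {I} noCircuit with any (Matroid.circ M) (subsetsOf I) in eq
  ... | false = refl
  ... | true  = let C , C∈ , C-circ = any-true⁻ (Matroid.circ M) (subsetsOf I) eq in
                ⊥-elim (noCircuit C (∈-subsetsOf⁻ C∈) C-circ)

  independent⁻ : ∀ {I C} → Independent M I → C ⊆ I → ¬ IsCircuit M C
  independent⁻ ind C⊆I C-circ =
    true≢false (trans (sym ind) (cong not (any-true⁺ (Matroid.circ M) (∈-subsetsOf⁺ C⊆I) C-circ)))

  dependent⁻ : ∀ {I} → ¬ Independent M I → ∃ λ C → C ⊆ I × IsCircuit M C
  dependent⁻ {I} dep with any (Matroid.circ M) (subsetsOf I) in eq
  ... | false = ⊥-elim (dep refl)
  ... | true  = let C , C∈ , C-circ = any-true⁻ (Matroid.circ M) (subsetsOf I) eq in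
                C , ∈-subsetsOf⁻ C∈ , C-circ

  independent-∅ : ¬ IsCircuit M ∅ → Independent M ∅
  independent-∅ ¬∅ = independent⁺ λ C C⊆∅ → subst (λ C → ¬ IsCircuit M C) (sym (⊆-antisym C⊆∅ ⊥⊆)) ¬∅

module _ {k} (M : Matroid k) where

  private
    maxIndependent : List (Subset k) → ℕ
    maxIndependent = foldr (λ I r → if independentᵇ M I then ∣ I ∣ ⊔ r else r) 0

    maxIndependent-≥ : ∀ {L I} → I ∈ₗ L → Independent M I → ∣ I ∣ ≤ maxIndependent L
    maxIndependent-≥ {I ∷ L} (Any.here refl) ind rewrite ind = ℕₚ.m≤m⊔n ∣ I ∣ (maxIndependent L)
    maxIndependent-≥ {J ∷ L} (Any.there I∈L) ind with independentᵇ M J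
    ... | true  = ℕₚ.m≤n⇒m≤o⊔n ∣ J ∣ (maxIndependent-≥ I∈L ind)
    ... | false = maxIndependent-≥ I∈L ind

    maxIndependent-≤ : ∀ {L r} → (∀ {I} → I ∈ₗ L → Independent M I → ∣ I ∣ ≤ r) → maxIndependent L ≤ r
    maxIndependent-≤ {[]}    bound = z≤n
    maxIndependent-≤ {J ∷ L} bound with independentᵇ M J in ind
    ... | true  = ℕₚ.⊔-lub (bound (Any.here refl) ind) (maxIndependent-≤ (bound ∘ Any.there))
    ... | false = maxIndependent-≤ (bound ∘ Any.there)

    maxIndependent-attained : ∀ L → maxIndependent L ≡ 0 ⊎
                              ∃ λ I → I ∈ₗ L × Independent M I × ∣ I ∣ ≡ maxIndependent L
    maxIndependent-attained [] = inj₁ refl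
    maxIndependent-attained (J ∷ L) with independentᵇ M J in ind
    ... | false = Data.Sum.map₂ (λ (I , I∈L , rest) → I , Any.there I∈L , rest) (maxIndependent-attained L)
    ... | true with ℕₚ.⊔-sel ∣ J ∣ (maxIndependent L)
    ...   | inj₁ J-max = inj₂ (J , Any.here refl , ind , sym J-max)
    ...   | inj₂ L-max =
      Data.Sum.map (trans L-max) (λ (I , I∈L , indI , size) → I , Any.there I∈L , indI , trans size (sym L-max))
                   (maxIndependent-attained L)

  rank-≥ : ∀ {A I} → I ⊆ A → Independent M I → ∣ I ∣ ≤ rank M A
  rank-≥ I⊆A = maxIndependent-≥ (∈-subsetsOf⁺ I⊆A)

  rank-≤ : ∀ {A r} → (∀ {I} → I ⊆ A → Independent M I → ∣ I ∣ ≤ r) → rank M A ≤ r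
  rank-≤ bound = maxIndependent-≤ (bound ∘ ∈-subsetsOf⁻)

  rank-unique : ∀ {A I r} → (∀ {J} → J ⊆ A → Independent M J → ∣ J ∣ ≤ r) →
                I ⊆ A → Independent M I → ∣ I ∣ ≡ r → rank M A ≡ r
  rank-unique bound I⊆A indI refl = ℕₚ.≤-antisym (rank-≤ bound) (rank-≥ I⊆A indI)

  rank-mono : ∀ {A B} → A ⊆ B → rank M A ≤ rank M B
  rank-mono A⊆B = rank-≤ λ I⊆A → rank-≥ (⊆-trans I⊆A A⊆B)

  rank≤size : ∀ A → rank M A ≤ ∣ A ∣
  rank≤size A = rank-≤ λ I⊆A _ → p⊆q⇒∣p∣≤∣q∣ I⊆A

  rank-attained : ¬ IsCircuit M ∅ → ∀ A → ∃ λ I → I ⊆ A × Independent M I × ∣ I ∣ ≡ rank M A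
  rank-attained ¬∅ A with maxIndependent-attained (subsetsOf A)
  ... | inj₁ rank≡0          = ∅ , ⊥⊆ , independent-∅ M ¬∅ , trans (∣⊥∣≡0 k) (sym rank≡0)
  ... | inj₂ (I , I∈ , rest) = I , ∈-subsetsOf⁻ I∈ , rest

module _ (a : ℕ) {b} (M : Matroid (a + b)) where

  private
    variable
      Y C : Subset a
      Z D : Subset b

  independent-++⁺ : (∀ {C D} → C ⊆ Y → D ⊆ Z → ¬ IsCircuit M (C ++ D)) → Independent M (Y ++ Z)
  independent-++⁺ noCircuit = independent⁺ M λ X X⊆ →
    let C , D , X≡C++D = splitAt a X
        C⊆Y , D⊆Z = ++-⊆⁻ {C = C} {D = D} (subst (_⊆ _) X≡C++D X⊆)
    in subst (λ X → ¬ IsCircuit M X) (sym X≡C++D) (noCircuit {C} {D} C⊆Y D⊆Z)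

  independent-++⁻ : Independent M (Y ++ Z) → C ⊆ Y → D ⊆ Z → ¬ IsCircuit M (C ++ D)
  independent-++⁻ ind C⊆Y D⊆Z = independent⁻ M ind (++-⊆⁺ C⊆Y D⊆Z)

  rank-++ : ∀ {r} → (∀ {C D} → C ⊆ Y → D ⊆ Z → Independent M (C ++ D) → ∣ C ∣ + ∣ D ∣ ≤ r) →
            C ⊆ Y → D ⊆ Z → Independent M (C ++ D) → ∣ C ∣ + ∣ D ∣ ≡ r → rank M (Y ++ Z) ≡ r
  rank-++ {Y = Y} {Z = Z} {C = C} {D = D} {r = r} bound C⊆Y D⊆Z ind size =
    rank-unique M bound′ (++-⊆⁺ C⊆Y D⊆Z) ind (trans (∣++∣ C D) size)
    where
    bound′ : ∀ {I} → I ⊆ Y ++ Z → Independent M I → ∣ I ∣ ≤ r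
    bound′ {I} I⊆ indI =
      let C′ , D′ , I≡C′++D′ = splitAt a I
          C′⊆Y , D′⊆Z = ++-⊆⁻ (subst (_⊆ _) I≡C′++D′ I⊆)
      in subst (_≤ r) (sym (trans (cong ∣_∣ I≡C′++D′) (∣++∣ C′ D′)))
               (bound {C′} {D′} C′⊆Y D′⊆Z (subst (Independent M) I≡C′++D′ indI))

-- Sums over subsets

sumSubsets : (k : ℕ) → (Subset k → ℤ) → ℤ
sumSubsets k f = sumℤ (map f (allSubsets k))

module _ {A : Set} where

  sumℤ-map-cong : ∀ {f g : A → ℤ} → (∀ a → f a ≡ g a) → ∀ xs → sumℤ (map f xs) ≡ sumℤ (map g xs)
  sumℤ-map-cong f≗g []       = refl
  sumℤ-map-cong f≗g (x ∷ xs) = cong₂ _+ℤ_ (f≗g x) (sumℤ-map-cong f≗g xs)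

  sumℤ-map-+ : ∀ (f g : A → ℤ) xs → sumℤ (map (λ a → f a +ℤ g a) xs) ≡ sumℤ (map f xs) +ℤ sumℤ (map g xs)
  sumℤ-map-+ f g []       = refl
  sumℤ-map-+ f g (x ∷ xs) = trans (cong (f x +ℤ g x +ℤ_) (sumℤ-map-+ f g xs)) (interchange (f x) (g x) _ _)
    where
    interchange : ∀ a b c d → (a +ℤ b) +ℤ (c +ℤ d) ≡ (a +ℤ c) +ℤ (b +ℤ d)
    interchange = solve-∀

  sumℤ-map-*ˡ : ∀ c (f : A → ℤ) xs → sumℤ (map (λ a → c *ℤ f a) xs) ≡ c *ℤ sumℤ (map f xs)
  sumℤ-map-*ˡ c f []       = sym (ℤₚ.*-zeroʳ c)
  sumℤ-map-*ˡ c f (x ∷ xs) = trans (cong (c *ℤ f x +ℤ_) (sumℤ-map-*ˡ c f xs)) (sym (ℤₚ.*-distribˡ-+ c (f x) _))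

sumSubsets-cong : ∀ k {f g : Subset k → ℤ} → (∀ A → f A ≡ g A) → sumSubsets k f ≡ sumSubsets k g
sumSubsets-cong k f≗g = sumℤ-map-cong f≗g (allSubsets k)

sumSubsets-+ : ∀ k (f g : Subset k → ℤ) → sumSubsets k (λ A → f A +ℤ g A) ≡ sumSubsets k f +ℤ sumSubsets k g
sumSubsets-+ k f g = sumℤ-map-+ f g (allSubsets k)

sumSubsets-*ˡ : ∀ k c (f : Subset k → ℤ) → sumSubsets k (λ A → c *ℤ f A) ≡ c *ℤ sumSubsets k f
sumSubsets-*ˡ k c f = sumℤ-map-*ˡ c f (allSubsets k)

sumSubsets-*ʳ : ∀ k c (f : Subset k → ℤ) → sumSubsets k (λ A → f A *ℤ c) ≡ sumSubsets k f *ℤ c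
sumSubsets-*ʳ k c f = begin
  sumSubsets k (λ A → f A *ℤ c) ≡⟨ sumSubsets-cong k (λ A → ℤₚ.*-comm (f A) c) ⟩
  sumSubsets k (λ A → c *ℤ f A) ≡⟨ sumSubsets-*ˡ k c f ⟩
  c *ℤ sumSubsets k f           ≡⟨ ℤₚ.*-comm c _ ⟩
  sumSubsets k f *ℤ c           ∎
  where open ≡-Reasoning

sumSubsets-suc : ∀ k (f : Subset (suc k) → ℤ) →
                 sumSubsets (suc k) f ≡ sumSubsets k (λ s → f (outside ∷ s) +ℤ f (inside ∷ s))
sumSubsets-suc k f = go (allSubsets k)
  where
  go : ∀ ss → sumℤ (map f (concatMap (λ s → (outside ∷ s) ∷ (inside ∷ s) ∷ []) ss))
            ≡ sumℤ (map (λ s → f (outside ∷ s) +ℤ f (inside ∷ s)) ss)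
  go []       = refl
  go (s ∷ ss) = trans (cong (λ rest → f (outside ∷ s) +ℤ (f (inside ∷ s) +ℤ rest)) (go ss))
                      (sym (ℤₚ.+-assoc (f (outside ∷ s)) _ _))

sumSubsets-++ : ∀ a {b} (f : Subset (a + b) → ℤ) →
                sumSubsets (a + b) f ≡ sumSubsets a (λ Y → sumSubsets b (λ Z → f (Y ++ Z)))
sumSubsets-++ zero    {b} f = sym (ℤₚ.+-identityʳ (sumSubsets b f))
sumSubsets-++ (suc a) {b} f = begin
  sumSubsets (suc (a + b)) f
    ≡⟨ sumSubsets-suc (a + b) f ⟩
  sumSubsets (a + b) (λ s → f (outside ∷ s) +ℤ f (inside ∷ s))
    ≡⟨ sumSubsets-++ a _ ⟩
  sumSubsets a (λ Y → sumSubsets b (λ Z → f (outside ∷ Y ++ Z) +ℤ f (inside ∷ Y ++ Z)))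
    ≡⟨ sumSubsets-cong a (λ Y → sumSubsets-+ b _ _) ⟩
  sumSubsets a (λ Y → sumSubsets b (λ Z → f (outside ∷ Y ++ Z)) +ℤ sumSubsets b (λ Z → f (inside ∷ Y ++ Z)))
    ≡⟨ sumSubsets-suc a _ ⟨
  sumSubsets (suc a) (λ Y → sumSubsets b (λ Z → f (Y ++ Z))) ∎
  where open ≡-Reasoning

sumSubsets-insertAt : ∀ {k} (i : Fin (suc k)) (f : Subset (suc k) → ℤ) →
  sumSubsets (suc k) f ≡ sumSubsets k (λ s → f (insertAt s i outside) +ℤ f (insertAt s i inside))
sumSubsets-insertAt {k}     zero    f = sumSubsets-suc k f
sumSubsets-insertAt {suc k} (suc i) f = begin
  sumSubsets (suc (suc k)) f
    ≡⟨ sumSubsets-suc (suc k) f ⟩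
  sumSubsets (suc k) (λ t → f (outside ∷ t) +ℤ f (inside ∷ t))
    ≡⟨ sumSubsets-+ (suc k) _ _ ⟩
  sumSubsets (suc k) (λ t → f (outside ∷ t)) +ℤ sumSubsets (suc k) (λ t → f (inside ∷ t))
    ≡⟨ cong₂ _+ℤ_ (sumSubsets-insertAt i _) (sumSubsets-insertAt i _) ⟩
  sumSubsets k (λ s → f (outside ∷ insertAt s i outside) +ℤ f (outside ∷ insertAt s i inside)) +ℤ
  sumSubsets k (λ s → f (inside ∷ insertAt s i outside) +ℤ f (inside ∷ insertAt s i inside))
    ≡⟨ sumSubsets-+ k _ _ ⟨
  sumSubsets k (λ s → (f (outside ∷ insertAt s i outside) +ℤ f (outside ∷ insertAt s i inside)) +ℤ
                      (f (inside ∷ insertAt s i outside) +ℤ f (inside ∷ insertAt s i inside)))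
    ≡⟨ sumSubsets-suc k _ ⟨
  sumSubsets (suc k) (λ s → f (insertAt s (suc i) outside) +ℤ f (insertAt s (suc i) inside)) ∎
  where open ≡-Reasoning

tutteMonomial : ℤ → ℤ → (R r n : ℕ) → ℤ
tutteMonomial x y R r n = (x - + 1) ^ (R ∸ r) *ℤ (y - + 1) ^ (n ∸ r)

tutteTerm : ∀ {k} → Matroid k → ℤ → ℤ → Subset k → ℤ
tutteTerm M x y A = tutteMonomial x y (rank M ⊤) (rank M A) ∣ A ∣

[m+n]∸[o+p]≡[m∸o]+[n∸p] : ∀ {m n o p} → o ≤ m → p ≤ n → (m + n) ∸ (o + p) ≡ (m ∸ o) + (n ∸ p)
[m+n]∸[o+p]≡[m∸o]+[n∸p] {m} {n} {o} {p} o≤m p≤n = begin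
  (m + n) ∸ (o + p)   ≡⟨ ℕₚ.∸-+-assoc (m + n) o p ⟨
  (m + n) ∸ o ∸ p     ≡⟨ cong (_∸ p) (ℕₚ.+-∸-comm n o≤m) ⟩
  (m ∸ o) + n ∸ p     ≡⟨ ℕₚ.+-∸-assoc (m ∸ o) p≤n ⟩
  (m ∸ o) + (n ∸ p)   ∎
  where open ≡-Reasoning

tutteMonomial-+ : ∀ x y {a b c d e f} → c ≤ a → c ≤ e → d ≤ b → d ≤ f →
  tutteMonomial x y (a + b) (c + d) (e + f) ≡ tutteMonomial x y a c e *ℤ tutteMonomial x y b d f
tutteMonomial-+ x y {a} {b} {c} {d} {e} {f} c≤a c≤e d≤b d≤f = begin
  X ^ ((a + b) ∸ (c + d)) *ℤ Y ^ ((e + f) ∸ (c + d))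
    ≡⟨ cong₂ (λ u v → X ^ u *ℤ Y ^ v) ([m+n]∸[o+p]≡[m∸o]+[n∸p] c≤a d≤b) ([m+n]∸[o+p]≡[m∸o]+[n∸p] c≤e d≤f) ⟩
  X ^ ((a ∸ c) + (b ∸ d)) *ℤ Y ^ ((e ∸ c) + (f ∸ d))
    ≡⟨ cong₂ _*ℤ_ (ℤₚ.^-distribˡ-+-* X (a ∸ c) (b ∸ d)) (ℤₚ.^-distribˡ-+-* Y (e ∸ c) (f ∸ d)) ⟩
  (X ^ (a ∸ c) *ℤ X ^ (b ∸ d)) *ℤ (Y ^ (e ∸ c) *ℤ Y ^ (f ∸ d))
    ≡⟨ interchange (X ^ (a ∸ c)) (X ^ (b ∸ d)) (Y ^ (e ∸ c)) (Y ^ (f ∸ d)) ⟩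
  tutteMonomial x y a c e *ℤ tutteMonomial x y b d f ∎
  where
  open ≡-Reasoning
  X = x - + 1
  Y = y - + 1
  interchange : ∀ p q r s → (p *ℤ q) *ℤ (r *ℤ s) ≡ (p *ℤ r) *ℤ (q *ℤ s)
  interchange = solve-∀

tutteMonomial-cancelˡ : ∀ x y c {R r n} → tutteMonomial x y (c + R) (c + r) (c + n) ≡ tutteMonomial x y R r n
tutteMonomial-cancelˡ x y c {R} {r} {n} =
  cong₂ (λ u v → (x - + 1) ^ u *ℤ (y - + 1) ^ v) (ℕₚ.[m+n]∸[m+o]≡n∸o c R r) (ℕₚ.[m+n]∸[m+o]≡n∸o c n r)

sumPow-suc : ∀ x k → sumPow x (suc k) ≡ sumPow x k +ℤ x ^ suc k
sumPow-suc x k = go suc k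
  where
  go : ∀ (f : ℕ → ℕ) j → sumℤ (map (x ^_) (applyUpTo f (suc j))) ≡ sumℤ (map (x ^_) (applyUpTo f j)) +ℤ x ^ f j
  go f zero    = trans (ℤₚ.+-identityʳ (x ^ f 0)) (sym (ℤₚ.+-identityˡ (x ^ f 0)))
  go f (suc j) = trans (cong (x ^ f 0 +ℤ_) (go (f ∘ suc) j)) (sym (ℤₚ.+-assoc (x ^ f 0) _ _))

sumPow-suc-factor : ∀ x k → sumPow x (suc k) ≡ x *ℤ (sumPow x k +ℤ + 1)
sumPow-suc-factor x zero    = step x
  where
  step : ∀ x → x *ℤ + 1 +ℤ + 0 ≡ x *ℤ (+ 0 +ℤ + 1)
  step = solve-∀
sumPow-suc-factor x (suc k) = begin
  sumPow x (suc (suc k))               ≡⟨ sumPow-suc x (suc k) ⟩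
  sumPow x (suc k) +ℤ x ^ suc (suc k)  ≡⟨ cong (_+ℤ x ^ suc (suc k)) (sumPow-suc-factor x k) ⟩
  x *ℤ (sumPow x k +ℤ + 1) +ℤ x *ℤ x ^ suc k
    ≡⟨ step x (sumPow x k) (x ^ suc k) ⟩
  x *ℤ ((sumPow x k +ℤ x ^ suc k) +ℤ + 1) ≡⟨ cong (λ s → x *ℤ (s +ℤ + 1)) (sumPow-suc x k) ⟨
  x *ℤ (sumPow x (suc k) +ℤ + 1)       ∎
  where
  open ≡-Reasoning
  step : ∀ x s p → x *ℤ (s +ℤ + 1) +ℤ x *ℤ p ≡ x *ℤ ((s +ℤ p) +ℤ + 1)
  step = solve-∀

sumSubsets-binomial : ∀ x n → sumSubsets n (λ A → (x - + 1) ^ (n ∸ ∣ A ∣)) ≡ x ^ n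
sumSubsets-binomial x zero    = refl
sumSubsets-binomial x (suc n) = begin
  sumSubsets (suc n) (λ A → X ^ (suc n ∸ ∣ A ∣))
    ≡⟨ sumSubsets-suc n _ ⟩
  sumSubsets n (λ s → X ^ (suc n ∸ ∣ s ∣) +ℤ X ^ (n ∸ ∣ s ∣))
    ≡⟨ sumSubsets-cong n (λ s → cong (λ e → X ^ e +ℤ X ^ (n ∸ ∣ s ∣)) (ℕₚ.+-∸-assoc 1 (∣p∣≤n s))) ⟩
  sumSubsets n (λ s → X *ℤ X ^ (n ∸ ∣ s ∣) +ℤ X ^ (n ∸ ∣ s ∣))
    ≡⟨ sumSubsets-cong n (λ s → step x (X ^ (n ∸ ∣ s ∣))) ⟩
  sumSubsets n (λ s → x *ℤ X ^ (n ∸ ∣ s ∣))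
    ≡⟨ sumSubsets-*ˡ n x _ ⟩
  x *ℤ sumSubsets n (λ s → X ^ (n ∸ ∣ s ∣))
    ≡⟨ cong (x *ℤ_) (sumSubsets-binomial x n) ⟩
  x ^ suc n ∎
  where
  open ≡-Reasoning
  X = x - + 1
  step : ∀ x p → (x - + 1) *ℤ p +ℤ p ≡ x *ℤ p
  step = solve-∀

sumSubsets-geometric : ∀ x n c u (f : Subset (suc n) → ℤ) → f ⊤ ≡ u →
  (∀ A → A ≢ ⊤ → f A ≡ c *ℤ (x - + 1) ^ (n ∸ ∣ A ∣)) →
  sumSubsets (suc n) f ≡ c *ℤ (sumPow x n +ℤ + 1) +ℤ u
sumSubsets-geometric x zero c u f f⊤ fA = begin
  f (outside ∷ []) +ℤ (f ⊤ +ℤ + 0)  ≡⟨ cong₂ (λ a b → a +ℤ (b +ℤ + 0)) (fA (outside ∷ []) λ ()) f⊤ ⟩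
  c *ℤ + 1 +ℤ (u +ℤ + 0)           ≡⟨ step c u ⟩
  c *ℤ (+ 0 +ℤ + 1) +ℤ u           ∎
  where
  open ≡-Reasoning
  step : ∀ c u → c *ℤ + 1 +ℤ (u +ℤ + 0) ≡ c *ℤ (+ 0 +ℤ + 1) +ℤ u
  step = solve-∀
sumSubsets-geometric x (suc n) c u f f⊤ fA = begin
  sumSubsets (suc (suc n)) f
    ≡⟨ trans (sumSubsets-suc (suc n) f) (sumSubsets-+ (suc n) _ _) ⟩
  sumSubsets (suc n) (λ s → f (outside ∷ s)) +ℤ sumSubsets (suc n) (λ s → f (inside ∷ s))
    ≡⟨ cong₂ _+ℤ_ outsideSum insideSum ⟩
  c *ℤ x ^ suc n +ℤ (c *ℤ (sumPow x n +ℤ + 1) +ℤ u)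
    ≡⟨ step c (x ^ suc n) (sumPow x n) u ⟩
  c *ℤ ((sumPow x n +ℤ x ^ suc n) +ℤ + 1) +ℤ u
    ≡⟨ cong (λ s → c *ℤ (s +ℤ + 1) +ℤ u) (sumPow-suc x n) ⟨
  c *ℤ (sumPow x (suc n) +ℤ + 1) +ℤ u ∎
  where
  open ≡-Reasoning
  step : ∀ c p s u → c *ℤ p +ℤ (c *ℤ (s +ℤ + 1) +ℤ u) ≡ c *ℤ ((s +ℤ p) +ℤ + 1) +ℤ u
  step = solve-∀
  outsideSum : sumSubsets (suc n) (λ s → f (outside ∷ s)) ≡ c *ℤ x ^ suc n
  outsideSum = begin
    sumSubsets (suc n) (λ s → f (outside ∷ s))
      ≡⟨ sumSubsets-cong (suc n) (λ s → fA (outside ∷ s) λ ()) ⟩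
    sumSubsets (suc n) (λ s → c *ℤ (x - + 1) ^ (suc n ∸ ∣ s ∣))
      ≡⟨ sumSubsets-*ˡ (suc n) c _ ⟩
    c *ℤ sumSubsets (suc n) (λ s → (x - + 1) ^ (suc n ∸ ∣ s ∣))
      ≡⟨ cong (c *ℤ_) (sumSubsets-binomial x (suc n)) ⟩
    c *ℤ x ^ suc n ∎
  insideSum : sumSubsets (suc n) (λ s → f (inside ∷ s)) ≡ c *ℤ (sumPow x n +ℤ + 1) +ℤ u
  insideSum = sumSubsets-geometric x n c u (f ∘ (inside ∷_)) f⊤ (λ A A≢⊤ → fA (inside ∷ A) (A≢⊤ ∘ ∷-injectiveʳ))

-- Direct sums, C_n and S

module _ {a b} (M : Matroid a) (N : Matroid b) where

  private
    circ-⊕ : ∀ Y Z → Matroid.circ (M ⊕ N) (Y ++ Z) ≡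
             (Matroid.circ M Y ∧ isEmptyᵇ Z) ∨ (isEmptyᵇ Y ∧ Matroid.circ N Z)
    circ-⊕ Y Z = cong₂ (λ U W → (Matroid.circ M U ∧ isEmptyᵇ W) ∨ (isEmptyᵇ U ∧ Matroid.circ N W))
                       (take-++ Y Z) (drop-++ Y Z)

  circuit-⊕⁻ : ∀ {Y Z} → IsCircuit (M ⊕ N) (Y ++ Z) → IsCircuit M Y ⊎ IsCircuit N Z
  circuit-⊕⁻ {Y} {Z} circ with ∨-true⁻ (trans (sym (circ-⊕ Y Z)) circ)
  ... | inj₁ left  = inj₁ (proj₁ (∧-true⁻ left))
  ... | inj₂ right = inj₂ (proj₂ (∧-true⁻ {isEmptyᵇ Y} right))

  independent-⊕⁺ : ∀ {Y Z} → Independent M Y → Independent N Z → Independent (M ⊕ N) (Y ++ Z)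
  independent-⊕⁺ indY indZ = independent-++⁺ a (M ⊕ N) λ C⊆Y D⊆Z circ →
    Data.Sum.[ independent⁻ M indY C⊆Y , independent⁻ N indZ D⊆Z ] (circuit-⊕⁻ circ)

  independent-⊕⁻ : ∀ {Y Z} → Independent (M ⊕ N) (Y ++ Z) → Independent M Y × Independent N Z
  independent-⊕⁻ {Y} {Z} ind = independent⁺ M (λ C C⊆Y circ → independent-++⁻ a (M ⊕ N) ind C⊆Y ⊥⊆ (inM circ))
                             , independent⁺ N (λ D D⊆Z circ → independent-++⁻ a (M ⊕ N) ind ⊥⊆ D⊆Z (inN circ))
    where
    inM : ∀ {C} → IsCircuit M C → IsCircuit (M ⊕ N) (C ++ ∅)
    inM {C} circ = trans (circ-⊕ C ∅) (∨-true⁺ˡ (isEmptyᵇ C ∧ Matroid.circ N ∅) (∧-true⁺ circ (isEmptyᵇ-∅ {b})))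
    inN : ∀ {D} → IsCircuit N D → IsCircuit (M ⊕ N) (∅ ++ D)
    inN {D} circ = trans (circ-⊕ ∅ D) (∨-true⁺ʳ (Matroid.circ M ∅ ∧ isEmptyᵇ D) (∧-true⁺ (isEmptyᵇ-∅ {a}) circ))

  rank-⊕ : ¬ IsCircuit M ∅ → ¬ IsCircuit N ∅ → ∀ Y Z → rank (M ⊕ N) (Y ++ Z) ≡ rank M Y + rank N Z
  rank-⊕ ¬∅M ¬∅N Y Z =
    let C , C⊆Y , indC , sizeC = rank-attained M ¬∅M Y
        D , D⊆Z , indD , sizeD = rank-attained N ¬∅N Z
    in rank-++ a (M ⊕ N) bound C⊆Y D⊆Z (independent-⊕⁺ indC indD) (cong₂ _+_ sizeC sizeD)
    where
    bound : ∀ {C D} → C ⊆ Y → D ⊆ Z → Independent (M ⊕ N) (C ++ D) → ∣ C ∣ + ∣ D ∣ ≤ rank M Y + rank N Z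
    bound C⊆Y D⊆Z ind = let indC , indD = independent-⊕⁻ ind in
                        ℕₚ.+-mono-≤ (rank-≥ M C⊆Y indC) (rank-≥ N D⊆Z indD)

  Tutte-⊕ : ¬ IsCircuit M ∅ → ¬ IsCircuit N ∅ → ∀ x y → Tutte (M ⊕ N) x y ≡ Tutte M x y *ℤ Tutte N x y
  Tutte-⊕ ¬∅M ¬∅N x y = begin
    sumSubsets (a + b) (tutteTerm (M ⊕ N) x y)
      ≡⟨ sumSubsets-++ a _ ⟩
    sumSubsets a (λ Y → sumSubsets b (λ Z → tutteTerm (M ⊕ N) x y (Y ++ Z)))
      ≡⟨ sumSubsets-cong a (λ Y → sumSubsets-cong b (term-++ Y)) ⟩
    sumSubsets a (λ Y → sumSubsets b (λ Z → tutteTerm M x y Y *ℤ tutteTerm N x y Z))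
      ≡⟨ sumSubsets-cong a (λ Y → sumSubsets-*ˡ b (tutteTerm M x y Y) _) ⟩
    sumSubsets a (λ Y → tutteTerm M x y Y *ℤ Tutte N x y)
      ≡⟨ sumSubsets-*ʳ a _ _ ⟩
    Tutte M x y *ℤ Tutte N x y ∎
    where
    open ≡-Reasoning
    term-++ : ∀ Y Z → tutteTerm (M ⊕ N) x y (Y ++ Z) ≡ tutteTerm M x y Y *ℤ tutteTerm N x y Z
    term-++ Y Z = begin
      tutteMonomial x y (rank (M ⊕ N) ⊤) (rank (M ⊕ N) (Y ++ Z)) ∣ Y ++ Z ∣
        ≡⟨ cong (λ R → tutteMonomial x y R (rank (M ⊕ N) (Y ++ Z)) ∣ Y ++ Z ∣)
                (trans (cong (rank (M ⊕ N)) (⊤-++ a)) (rank-⊕ ¬∅M ¬∅N ⊤ ⊤)) ⟩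
      tutteMonomial x y (rank M ⊤ + rank N ⊤) (rank (M ⊕ N) (Y ++ Z)) ∣ Y ++ Z ∣
        ≡⟨ cong₂ (tutteMonomial x y (rank M ⊤ + rank N ⊤)) (rank-⊕ ¬∅M ¬∅N Y Z) (∣++∣ Y Z) ⟩
      tutteMonomial x y (rank M ⊤ + rank N ⊤) (rank M Y + rank N Z) (∣ Y ∣ + ∣ Z ∣)
        ≡⟨ tutteMonomial-+ x y (rank-mono M ⊆⊤) (rank≤size M Y) (rank-mono N ⊆⊤) (rank≤size N Z) ⟩
      tutteTerm M x y Y *ℤ tutteTerm N x y Z ∎

module _ (n : ℕ) where

  independent-Cyc : ∀ {I} → I ≢ ⊤ → Independent (Cyc n) I
  independent-Cyc I≢⊤ = independent⁺ (Cyc n) λ C C⊆I C≡ᵇ⊤ →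
    I≢⊤ (⊆-antisym ⊆⊤ (subst (_⊆ _) (≡ᵇ⇒≡ C≡ᵇ⊤) C⊆I))

  dependent-Cyc-⊤ : ¬ Independent (Cyc n) ⊤
  dependent-Cyc-⊤ ind = independent⁻ (Cyc n) ind ⊆-refl (≡⇒≡ᵇ {p = ⊤ {n}} refl)

  rank-Cyc : ∀ {A} → A ≢ ⊤ → rank (Cyc n) A ≡ ∣ A ∣
  rank-Cyc A≢⊤ = rank-unique (Cyc n) (λ I⊆A _ → p⊆q⇒∣p∣≤∣q∣ I⊆A) ⊆-refl (independent-Cyc A≢⊤) refl

rank-Cyc-⊤ : ∀ n → rank (Cyc (suc n)) ⊤ ≡ n
rank-Cyc-⊤ n = rank-unique (Cyc (suc n)) {I = outside ∷ ⊤} bound ⊆⊤ (independent-Cyc (suc n) λ ()) (∣⊤∣≡n n)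
  where
  bound : ∀ {I} → I ⊆ ⊤ → Independent (Cyc (suc n)) I → ∣ I ∣ ≤ n
  bound _ ind =
    ℕₚ.≤-pred (p≢⊤⇒∣p∣<n λ I≡⊤ → dependent-Cyc-⊤ (suc n) (subst (Independent (Cyc (suc n))) I≡⊤ ind))

¬circuit-Cyc-∅ : ∀ n → ¬ IsCircuit (Cyc (suc n)) ∅
¬circuit-Cyc-∅ n ∅≡ᵇ⊤ with ≡ᵇ⇒≡ {p = ∅ {suc n}} {⊤} ∅≡ᵇ⊤
... | ()

Tutte-Cyc : ∀ n x y → Tutte (Cyc (suc n)) x y ≡ sumPow x n +ℤ y
Tutte-Cyc n x y = begin
  sumSubsets (suc n) (tutteTerm (Cyc (suc n)) x y)
    ≡⟨ sumSubsets-geometric x n (+ 1) (y - + 1) _ term-⊤ term-proper ⟩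
  + 1 *ℤ (sumPow x n +ℤ + 1) +ℤ (y - + 1)
    ≡⟨ simplify (sumPow x n) y ⟩
  sumPow x n +ℤ y ∎
  where
  open ≡-Reasoning
  X = x - + 1
  Y = y - + 1
  simplify : ∀ s y → + 1 *ℤ (s +ℤ + 1) +ℤ (y - + 1) ≡ s +ℤ y
  simplify = solve-∀
  term-⊤ : tutteTerm (Cyc (suc n)) x y ⊤ ≡ Y
  term-⊤ = begin
    tutteMonomial x y (rank (Cyc (suc n)) ⊤) (rank (Cyc (suc n)) ⊤) ∣ ⊤ {suc n} ∣
      ≡⟨ cong₂ (λ r s → tutteMonomial x y r r s) (rank-Cyc-⊤ n) (∣⊤∣≡n (suc n)) ⟩
    X ^ (n ∸ n) *ℤ Y ^ (suc n ∸ n)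
      ≡⟨ cong₂ (λ u v → X ^ u *ℤ Y ^ v) (ℕₚ.n∸n≡0 n) (ℕₚ.m+n∸n≡m 1 n) ⟩
    + 1 *ℤ (Y *ℤ + 1)
      ≡⟨ unit Y ⟩
    Y ∎
    where
    unit : ∀ a → + 1 *ℤ (a *ℤ + 1) ≡ a
    unit = solve-∀
  term-proper : ∀ A → A ≢ ⊤ → tutteTerm (Cyc (suc n)) x y A ≡ + 1 *ℤ X ^ (n ∸ ∣ A ∣)
  term-proper A A≢⊤ = begin
    tutteMonomial x y (rank (Cyc (suc n)) ⊤) (rank (Cyc (suc n)) A) ∣ A ∣
      ≡⟨ cong₂ (λ R r → tutteMonomial x y R r ∣ A ∣) (rank-Cyc-⊤ n) (rank-Cyc (suc n) A≢⊤) ⟩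
    X ^ (n ∸ ∣ A ∣) *ℤ Y ^ (∣ A ∣ ∸ ∣ A ∣)
      ≡⟨ cong (λ v → X ^ (n ∸ ∣ A ∣) *ℤ Y ^ v) (ℕₚ.n∸n≡0 ∣ A ∣) ⟩
    X ^ (n ∸ ∣ A ∣) *ℤ + 1
      ≡⟨ ℤₚ.*-comm _ (+ 1) ⟩
    + 1 *ℤ X ^ (n ∸ ∣ A ∣) ∎

Tutte-Spt : ∀ x y → Tutte Spt x y ≡ x
Tutte-Spt x y = simplify x
  where
  -- Tutte Spt x y computes to the terms (x − 1)·1·1 of ∅ and 1·1 of the whole ground set.
  simplify : ∀ x → (x - + 1) *ℤ + 1 *ℤ + 1 +ℤ (+ 1 *ℤ + 1 +ℤ + 0) ≡ x
  simplify = solve-∀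

-- Bases through a non-loop and contraction

module _ {n} {M : Matroid n} (isM : IsMatroid M) where

  -- A circuit D of the result passes through e (otherwise D ⊆ J) and differs from C (it misses j);
  -- eliminating e from C and D leaves a circuit inside J.
  independent-exchange : ∀ {J C e j} → Independent M J → IsCircuit M C → C ⊆ J ∪ ⁅ e ⁆ → j ∈ C →
                         Independent M ((J ∪ ⁅ e ⁆) ─ ⁅ j ⁆)
  independent-exchange {J} {C} {e} {j} indJ circC C⊆ j∈C = independent⁺ M noCircuit
    where
    inJ : ∀ {D} → e ∉ D → D ⊆ J ∪ ⁅ e ⁆ → ¬ IsCircuit M D
    inJ e∉D D⊆ = independent⁻ M indJ (x∉p⇒p⊆q∪⁅x⁆⇒p⊆q e∉D D⊆)
    e∈C : e ∈ C
    e∈C with e ∈? C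
    ... | yes e∈C = e∈C
    ... | no  e∉C = ⊥-elim (inJ e∉C C⊆ circC)
    noCircuit : ∀ D → D ⊆ (J ∪ ⁅ e ⁆) ─ ⁅ j ⁆ → ¬ IsCircuit M D
    noCircuit D D⊆ circD with e ∈? D
    ... | no  e∉D = inJ e∉D (⊆-trans D⊆ (p─q⊆p _ _)) circD
    ... | yes e∈D =
      let C≢D : C ≢ D
          C≢D = λ { refl → proj₂ (x∈p─⁅y⁆⁻ (D⊆ j∈C)) refl }
          F , circF , F⊆ = IsMatroid.C3 isM C D e circC circD C≢D e∈C e∈D
          C∪D⊆ : C ∪ D ⊆ J ∪ ⁅ e ⁆
          C∪D⊆ x∈ = Data.Sum.[ C⊆ , (p─q⊆p _ _) ∘ D⊆ ] (x∈p∪q⁻ C D x∈)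
      in independent⁻ M indJ (⊆-trans F⊆ (p⊆q∪⁅x⁆⇒p─⁅x⁆⊆q C∪D⊆)) circF

simple⇒nonloop : ∀ {n} {M : Matroid n} → Simple M → ∀ {e} → ¬ IsCircuit M ⁅ e ⁆
simple⇒nonloop simple {e} circ with subst (3 ≤_) (∣⁅x⁆∣≡1 e) (simple ⁅ e ⁆ circ)
... | s≤s ()

module _ {n} {M : Matroid n} (isM : IsMatroid M) {e : Fin n} (e-nonloop : ¬ IsCircuit M ⁅ e ⁆) where

  circuit⊈⁅e⁆ : ∀ {C} → IsCircuit M C → ¬ C ⊆ ⁅ e ⁆
  circuit⊈⁅e⁆ {C} circC C⊆e with e ∈? C
  ... | yes e∈C = e-nonloop (subst (IsCircuit M) (⊆-antisym C⊆e ⁅e⁆⊆C) circC)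
    where
    ⁅e⁆⊆C : ⁅ e ⁆ ⊆ C
    ⁅e⁆⊆C x∈ = subst (_∈ C) (sym (x∈⁅y⁆⇒x≡y e x∈)) e∈C
  ... | no  e∉C = IsMatroid.C1 isM (subst (IsCircuit M) (⊆-antisym C⊆∅ ⊥⊆) circC)
    where
    C⊆∅ : C ⊆ ∅
    C⊆∅ x∈C = ⊥-elim (e∉C (subst (_∈ C) (x∈⁅y⁆⇒x≡y e (C⊆e x∈C)) x∈C))

  circuit-other : ∀ {C} → IsCircuit M C → ∃ λ j → j ∈ C × j ≢ e
  circuit-other {C} circC with any? (λ j → j ∈? C ×-dec ¬? (j ≟ e))
  ... | yes found = found
  ... | no  none  = ⊥-elim (circuit⊈⁅e⁆ circC C⊆e)
    where
    C⊆e : C ⊆ ⁅ e ⁆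
    C⊆e {j} j∈C with j ≟ e
    ... | yes refl = x∈⁅x⁆ e
    ... | no  j≢e  = ⊥-elim (none (j , j∈C , j≢e))

  -- If a maximum independent J₀ ⊆ A misses e, then J₀ ∪ {e} contains a circuit through e and some j ≠ e;
  -- trading j for e keeps J₀ ∪ {e} − j independent and of the same size.
  basis-through : ∀ {A} → e ∈ A → ∃ λ J → J ⊆ A × e ∈ J × Independent M J × ∣ J ∣ ≡ rank M A
  basis-through {A} e∈A with rank-attained M (IsMatroid.C1 isM) A
  ... | J₀ , J₀⊆A , indJ₀ , sizeJ₀ with e ∈? J₀
  ...   | yes e∈J₀ = J₀ , J₀⊆A , e∈J₀ , indJ₀ , sizeJ₀
  ...   | no  e∉J₀ =
    let C , C⊆J₁ , circC = dependent⁻ M J₁-dependent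
        j , j∈C , j≢e = circuit-other circC
    in J₁ ─ ⁅ j ⁆ , ⊆-trans (p─q⊆p _ _) J₁⊆A , x∈p∧x≢y⇒x∈p-y (x∈p∪⁅x⁆ J₀ e) (j≢e ∘ sym) ,
       independent-exchange isM indJ₀ circC C⊆J₁ j∈C ,
       ℕₚ.suc-injective (trans (1+∣p─⁅x⁆∣≡∣p∣ (C⊆J₁ j∈C)) (trans (∣p∪⁅x⁆∣≡1+∣p∣ e∉J₀) (cong suc sizeJ₀)))
    where
    J₁ = J₀ ∪ ⁅ e ⁆
    J₁⊆A : J₁ ⊆ A
    J₁⊆A x∈ = Data.Sum.[ J₀⊆A , (λ { refl → e∈A }) ] (x∈p∪⁅y⁆⁻ x∈)
    J₁-dependent : ¬ Independent M J₁
    J₁-dependent indJ₁ = ℕₚ.<-irrefl refl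
      (subst (_≤ rank M A) (trans (∣p∪⁅x⁆∣≡1+∣p∣ e∉J₀) (cong suc sizeJ₀)) (rank-≥ M J₁⊆A indJ₁))

module _ {m} (M : Matroid (suc m)) (e : Fin (suc m)) where

  private
    M/e = contract M e

  -- The test that Defs.contract minimises: X is a nonempty trace C − e of a circuit C of M.
  isCircuitTraceᵇ : Subset m → Bool
  isCircuitTraceᵇ X = not (isEmptyᵇ X) ∧ any (λ C → Matroid.circ M C ∧ (dropPt e C ≡ᵇ X)) (allSubsets (suc m))

  circuitTrace⁺ : ∀ {C} → IsCircuit M C → dropPt e C ≢ ∅ → isCircuitTraceᵇ (dropPt e C) ≡ true
  circuitTrace⁺ {C} circC nonempty = ∧-true⁺
    (cong not (¬-not (nonempty ∘ isEmptyᵇ⇒≡∅)))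
    (any-true⁺ _ (∈-allSubsets C) (∧-true⁺ circC (≡⇒≡ᵇ {p = dropPt e C} refl)))

  circuit-contract⁻ : ∀ {X} → IsCircuit M/e X → ∃ λ C → IsCircuit M C × dropPt e C ≡ X
  circuit-contract⁻ {X} circX =
    let traceX = proj₁ (∧-true⁻ circX)
        C , _ , found = any-true⁻ _ (allSubsets (suc m)) (proj₂ (∧-true⁻ {not (isEmptyᵇ X)} traceX))
        circC , dropC≡ᵇX = ∧-true⁻ found
    in C , circC , ≡ᵇ⇒≡ dropC≡ᵇX

  -- The circuits of M/e are the minimal traces, so descending along strictly smaller traces ends in one.
  circuitTrace⇒circuit-contract : ∀ {X₀} → isCircuitTraceᵇ X₀ ≡ true → ∃ λ X → X ⊆ X₀ × IsCircuit M/e X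
  circuitTrace⇒circuit-contract {X₀} = go (suc ∣ X₀ ∣) ℕₚ.≤-refl
    where
    go : ∀ fuel {X₀} → ∣ X₀ ∣ < fuel → isCircuitTraceᵇ X₀ ≡ true → ∃ λ X → X ⊆ X₀ × IsCircuit M/e X
    go (suc fuel) {X₀} size<fuel traceX₀
      with all (λ Y → not (isCircuitTraceᵇ Y) ∨ (Y ≡ᵇ X₀)) (subsetsOf X₀) in minimal
    ... | true  = X₀ , ⊆-refl , ∧-true⁺ traceX₀ minimal
    ... | false =
      let Y , Y∈ , notMinimal = all-false⁻ _ (subsetsOf X₀) minimal
          Y⊆X₀ = ∈-subsetsOf⁻ Y∈
          Y≢X₀ = λ Y≡X₀ → true≢false (trans (sym (≡⇒≡ᵇ Y≡X₀)) (proj₂ (∨-false⁻ notMinimal)))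
          X , X⊆Y , circX = go fuel (ℕₚ.≤-trans (p⊆q∧p≢q⇒∣p∣<∣q∣ Y⊆X₀ Y≢X₀) (ℕₚ.≤-pred size<fuel))
                               (not-false⁻ (proj₁ (∨-false⁻ notMinimal)))
      in X , ⊆-trans X⊆Y Y⊆X₀ , circX

module _ {m} {M : Matroid (suc m)} (isM : IsMatroid M) {e : Fin (suc m)} (e-nonloop : ¬ IsCircuit M ⁅ e ⁆) where

  private
    M/e = contract M e

  independent-contract⁺ : ∀ {I} → Independent M (insertAt I e inside) → Independent M/e I
  independent-contract⁺ indI+e = independent⁺ M/e λ X X⊆I circX →
    let C , circC , dropC≡X = circuit-contract⁻ M e circX
    in independent⁻ M indI+e (dropPt-⊆⇒⊆-insertAt e (subst (_⊆ _) (sym dropC≡X) X⊆I)) circC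

  independent-contract⁻ : ∀ {I} → Independent M/e I → Independent M (insertAt I e inside)
  independent-contract⁻ indI = independent⁺ M λ C C⊆I+e circC →
    let X , X⊆dropC , circX = circuitTrace⇒circuit-contract M e (circuitTrace⁺ M e circC (dropC≢∅ circC))
    in independent⁻ M/e indI (⊆-trans X⊆dropC (⊆-insertAt⇒dropPt-⊆ e C⊆I+e)) circX
    where
    dropC≢∅ : ∀ {C} → IsCircuit M C → dropPt e C ≢ ∅
    dropC≢∅ circC dropC≡∅ = circuit⊈⁅e⁆ isM e-nonloop circC
      (subst (_ ⊆_) (insertAt-∅ e) (dropPt-⊆⇒⊆-insertAt e (subst (_⊆ ∅) (sym dropC≡∅) ⊆-refl)))

  -- A basis of I ∪ {e} through e (basis-through) restricts to a basis of I in M/e.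
  rank-contract : ∀ I → rank M (insertAt I e inside) ≡ suc (rank M/e I)
  rank-contract I =
    let J , J⊆ , e∈J , indJ , sizeJ = basis-through isM e-nonloop (i∈insertAt-inside I e)
        J≡ : J ≡ insertAt (dropPt e J) e inside
        J≡ = trans (sym (insertAt-dropPt e J)) (cong (insertAt (dropPt e J) e) (Vecₚ.[]=⇒lookup e∈J))
        ∣J∣≡ = trans (cong ∣_∣ J≡) (∣insertAt-inside∣ (dropPt e J) e)
        bound : ∀ {I′} → I′ ⊆ I → Independent M/e I′ → ∣ I′ ∣ ≤ ∣ dropPt e J ∣
        bound {I′} I′⊆I indI′ = ℕₚ.≤-pred (subst₂ _≤_ (∣insertAt-inside∣ I′ e) (trans (sym sizeJ) ∣J∣≡)
          (rank-≥ M (insertAt-⊆⁺ e I′⊆I) (independent-contract⁻ indI′)))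
        rank/e≡ = rank-unique M/e bound (⊆-insertAt⇒dropPt-⊆ e J⊆)
                              (independent-contract⁺ (subst (Independent M) J≡ indJ)) refl
    in trans (sym sizeJ) (trans ∣J∣≡ (cong suc (sym rank/e≡)))

-- The parallel connection

module ParallelConnection (k : ℕ) {m} (M₀ : Matroid (suc m)) (ε₀ : Fin (suc m)) where

  P : Matroid (suc k + suc m)
  P = parallel (Cyc (suc (suc k))) zero M₀ ε₀

  -- In Y ++ Z, Y holds the classes of 2, …, k+2 and Z those of E₀, the class of ε₀ being {1, ε₀}. The
  -- constructors are the circuits in the definition of P: the image of [n], the circuits of M₀, and the
  -- glued sets (the image of [n] − 1) ∪ (C − ε₀).
  data ParallelCircuit : Subset (suc k) → Subset (suc m) → Set where
    cycle    : ParallelCircuit ⊤ ⁅ ε₀ ⁆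
    circuit₀ : ∀ {C} → IsCircuit M₀ C → ParallelCircuit ∅ C
    glued    : ∀ {C} → IsCircuit M₀ C → ε₀ ∈ C → ParallelCircuit ⊤ (C ─ ⁅ ε₀ ⁆)

  private
    variable
      F : Subset (suc k)
      B : Subset (suc m)

    cycleᵇ : Subset (suc (suc k)) → Subset (suc k) → Subset (suc m) → Bool
    cycleᵇ C Y Z = (C ≡ᵇ ⊤) ∧ ((dropPt zero C ≡ᵇ Y) ∧ ((if lookup C zero then ⁅ ε₀ ⁆ else ∅) ≡ᵇ Z))

    circuit₀ᵇ : Subset (suc m) → Subset (suc k) → Subset (suc m) → Bool
    circuit₀ᵇ C Y Z = Matroid.circ M₀ C ∧ ((∅ ≡ᵇ Y) ∧ (C ≡ᵇ Z))

    gluedᵇ : Subset (suc (suc k)) → Subset (suc k) → Subset (suc m) → Subset (suc m) → Bool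
    gluedᵇ C Y Z C′ = Matroid.circ M₀ C′ ∧ lookup C′ ε₀ ∧ ((dropPt zero C ≡ᵇ Y) ∧ ((C′ ─ ⁅ ε₀ ⁆) ≡ᵇ Z))

    glueᵇ : Subset (suc (suc k)) → Subset (suc k) → Subset (suc m) → Bool
    glueᵇ C Y Z = (C ≡ᵇ ⊤) ∧ lookup C zero ∧ any (gluedᵇ C Y Z) (allSubsets (suc m))

    parallelCircuitᵇ : Subset (suc k) → Subset (suc m) → Bool
    parallelCircuitᵇ Y Z = any (λ C → cycleᵇ C Y Z) (allSubsets (suc (suc k)))
                         ∨ any (λ C → circuit₀ᵇ C Y Z) (allSubsets (suc m))
                         ∨ any (λ C → glueᵇ C Y Z) (allSubsets (suc (suc k)))

    circ-parallel : ∀ Y Z → Matroid.circ P (Y ++ Z) ≡ parallelCircuitᵇ Y Z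
    circ-parallel Y Z = cong₂ parallelCircuitᵇ (take-++ Y Z) (drop-++ Y Z)

    dropPt-⊤ : dropPt zero (⊤ {suc (suc k)}) ≡ ⊤
    dropPt-⊤ = Vecₚ.tabulate∘lookup ⊤

    ≡ᵇ-pair⁻ : ∀ {n n′} {A Y : Subset n} {B Z : Subset n′} → ((A ≡ᵇ Y) ∧ (B ≡ᵇ Z)) ≡ true → Y ≡ A × Z ≡ B
    ≡ᵇ-pair⁻ {A = A} h = let A≡Y , B≡Z = ∧-true⁻ {A ≡ᵇ _} h in sym (≡ᵇ⇒≡ A≡Y) , sym (≡ᵇ⇒≡ B≡Z)

    ≡ᵇ-pair⁺ : ∀ {n n′} {A Y : Subset n} {B Z : Subset n′} → A ≡ Y → B ≡ Z → ((A ≡ᵇ Y) ∧ (B ≡ᵇ Z)) ≡ true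
    ≡ᵇ-pair⁺ A≡Y B≡Z = ∧-true⁺ (≡⇒≡ᵇ A≡Y) (≡⇒≡ᵇ B≡Z)

  circuit-parallel⁻ : ∀ Y Z → IsCircuit P (Y ++ Z) → ParallelCircuit Y Z
  circuit-parallel⁻ Y Z circ with ∨-true⁻ (trans (sym (circ-parallel Y Z)) circ)
  ... | inj₁ viaCycle =
    let C , _ , found = any-true⁻ _ (allSubsets (suc (suc k))) viaCycle
        C≡ᵇ⊤ , blocks = ∧-true⁻ {C ≡ᵇ ⊤} found
    in cycleCase (≡ᵇ⇒≡ {p = C} C≡ᵇ⊤) blocks
    where
    cycleCase : ∀ {C} → C ≡ ⊤ →
                ((dropPt zero C ≡ᵇ Y) ∧ ((if lookup C zero then ⁅ ε₀ ⁆ else ∅) ≡ᵇ Z)) ≡ true →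
                ParallelCircuit Y Z
    cycleCase refl blocks =
      let Y≡ , Z≡ = ≡ᵇ-pair⁻ blocks in subst₂ ParallelCircuit (sym (trans Y≡ dropPt-⊤)) (sym Z≡) cycle
  ... | inj₂ rest with ∨-true⁻ rest
  ... | inj₁ viaM₀ =
    let C , _ , found = any-true⁻ _ (allSubsets (suc m)) viaM₀
        circC , blocks = ∧-true⁻ found
        Y≡ , Z≡ = ≡ᵇ-pair⁻ blocks
    in subst₂ ParallelCircuit (sym Y≡) (sym Z≡) (circuit₀ circC)
  ... | inj₂ viaGlue =
    let C , _ , found = any-true⁻ _ (allSubsets (suc (suc k))) viaGlue
        C≡ᵇ⊤ , rest′ = ∧-true⁻ {C ≡ᵇ ⊤} found
        C′ , _ , found′ = any-true⁻ (gluedᵇ C Y Z) (allSubsets (suc m)) (proj₂ (∧-true⁻ {lookup C zero} rest′))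
        circC′ , rest″ = ∧-true⁻ found′
        ε₀∈C′ , blocks = ∧-true⁻ {lookup C′ ε₀} rest″
        Y≡ , Z≡ = ≡ᵇ-pair⁻ blocks
        Y≡⊤ = trans Y≡ (trans (cong (dropPt zero) (≡ᵇ⇒≡ {p = C} C≡ᵇ⊤)) dropPt-⊤)
    in subst₂ ParallelCircuit (sym Y≡⊤) (sym Z≡) (glued circC′ (Vecₚ.lookup⇒[]= ε₀ C′ ε₀∈C′))

  circuit-parallel⁺ : ∀ {Y Z} → ParallelCircuit Y Z → IsCircuit P (Y ++ Z)
  circuit-parallel⁺ {Y} {Z} pc = trans (circ-parallel Y Z) (viaCase pc)
    where
    ⊤≡ᵇ⊤ = ≡⇒≡ᵇ {p = ⊤ {suc (suc k)}} refl
    viaCase : ∀ {Y Z} → ParallelCircuit Y Z → parallelCircuitᵇ Y Z ≡ true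
    viaCase cycle = ∨-true⁺ˡ _
      (any-true⁺ (λ C → cycleᵇ C ⊤ ⁅ ε₀ ⁆) (∈-allSubsets ⊤)
        (∧-true⁺ ⊤≡ᵇ⊤ (≡ᵇ-pair⁺ {B = ⁅ ε₀ ⁆} dropPt-⊤ refl)))
    viaCase {Y} {Z} (circuit₀ {C} circC) =
      ∨-true⁺ʳ (any (λ C → cycleᵇ C Y Z) (allSubsets (suc (suc k))))
        (∨-true⁺ˡ _ (any-true⁺ (λ D → circuit₀ᵇ D ∅ C) (∈-allSubsets C)
          (∧-true⁺ circC (≡ᵇ-pair⁺ {A = ∅ {suc k}} {B = C} refl refl))))
    viaCase {Y} {Z} (glued {C} circC ε₀∈C) =
      ∨-true⁺ʳ (any (λ C → cycleᵇ C Y Z) (allSubsets (suc (suc k))))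
        (∨-true⁺ʳ (any (λ C → circuit₀ᵇ C Y Z) (allSubsets (suc m)))
          (any-true⁺ (λ D → glueᵇ D ⊤ (C ─ ⁅ ε₀ ⁆)) (∈-allSubsets ⊤) (∧-true⁺ ⊤≡ᵇ⊤ (∧-true⁺ refl
            (any-true⁺ (gluedᵇ ⊤ ⊤ (C ─ ⁅ ε₀ ⁆)) (∈-allSubsets C)
              (∧-true⁺ circC (∧-true⁺ (Vecₚ.[]=⇒lookup ε₀∈C) (≡ᵇ-pair⁺ {B = C ─ ⁅ ε₀ ⁆} dropPt-⊤ refl))))))))

  independent-parallel⁺ : (∀ {Y Z} → Y ⊆ F → Z ⊆ B → ¬ ParallelCircuit Y Z) → Independent P (F ++ B)
  independent-parallel⁺ noCircuit =
    independent-++⁺ (suc k) P λ {C} {D} C⊆F D⊆B circ → noCircuit C⊆F D⊆B (circuit-parallel⁻ C D circ)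

  independent-parallel⁻ : ∀ {Y Z} → Independent P (F ++ B) → Y ⊆ F → Z ⊆ B → ¬ ParallelCircuit Y Z
  independent-parallel⁻ ind Y⊆F Z⊆B pc = independent-++⁻ (suc k) P ind Y⊆F Z⊆B (circuit-parallel⁺ pc)

  independent-parallel⇒independent₀ : Independent P (F ++ B) → Independent M₀ B
  independent-parallel⇒independent₀ ind =
    independent⁺ M₀ λ C C⊆B circC → independent-parallel⁻ ind ⊥⊆ C⊆B (circuit₀ circC)

  independent-parallel-proper : F ≢ ⊤ → Independent M₀ B → Independent P (F ++ B)
  independent-parallel-proper F≢⊤ indB = independent-parallel⁺ λ where
    Y⊆F _   cycle            → F≢⊤ (⊆-antisym ⊆⊤ Y⊆F)
    _   Z⊆B (circuit₀ circC) → independent⁻ M₀ indB Z⊆B circC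
    Y⊆F _   (glued _ _)      → F≢⊤ (⊆-antisym ⊆⊤ Y⊆F)

  independent-parallel-full⁺ : ε₀ ∉ B → Independent M₀ (B ∪ ⁅ ε₀ ⁆) → Independent P (⊤ {suc k} ++ B)
  independent-parallel-full⁺ ε₀∉B indB+ε₀ = independent-parallel⁺ λ where
    _ Z⊆B cycle              → ε₀∉B (Z⊆B (x∈⁅x⁆ ε₀))
    _ Z⊆B (circuit₀ circC)   → independent⁻ M₀ indB+ε₀ (p⊆p∪q _ ∘ Z⊆B) circC
    _ Z⊆B (glued circC ε₀∈C) → independent⁻ M₀ indB+ε₀ (p─⁅x⁆⊆q⇒p⊆q∪⁅x⁆ Z⊆B) circC

  independent-parallel-full⁻ : Independent P (⊤ {suc k} ++ B) → ε₀ ∉ B × Independent M₀ (B ∪ ⁅ ε₀ ⁆)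
  independent-parallel-full⁻ {B = B} ind = ε₀∉B , independent⁺ M₀ noCircuit
    where
    ε₀∉B : ε₀ ∉ B
    ε₀∉B ε₀∈B = independent-parallel⁻ ind ⊆-refl (λ x∈ → subst (_∈ B) (sym (x∈⁅y⁆⇒x≡y ε₀ x∈)) ε₀∈B) cycle
    noCircuit : ∀ C → C ⊆ B ∪ ⁅ ε₀ ⁆ → ¬ IsCircuit M₀ C
    noCircuit C C⊆ circC with ε₀ ∈? C
    ... | yes ε₀∈C = independent-parallel⁻ ind ⊆-refl (p⊆q∪⁅x⁆⇒p─⁅x⁆⊆q C⊆) (glued circC ε₀∈C)
    ... | no  ε₀∉C = independent-parallel⁻ ind ⊥⊆ (x∉p⇒p⊆q∪⁅x⁆⇒p⊆q ε₀∉C C⊆) (circuit₀ circC)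

  module _ (isM : IsMatroid M₀) where

    rank-parallel-proper : ∀ {F} B → F ≢ ⊤ → rank P (F ++ B) ≡ ∣ F ∣ + rank M₀ B
    rank-parallel-proper {F} B F≢⊤ =
      let J , J⊆B , indJ , sizeJ = rank-attained M₀ (IsMatroid.C1 isM) B
      in rank-++ (suc k) P bound ⊆-refl J⊆B (independent-parallel-proper F≢⊤ indJ) (cong (_+_ ∣ F ∣) sizeJ)
      where
      bound : ∀ {C D} → C ⊆ F → D ⊆ B → Independent P (C ++ D) → ∣ C ∣ + ∣ D ∣ ≤ ∣ F ∣ + rank M₀ B
      bound C⊆F D⊆B ind =
        ℕₚ.+-mono-≤ (p⊆q⇒∣p∣≤∣q∣ C⊆F) (rank-≥ M₀ D⊆B (independent-parallel⇒independent₀ ind))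

    ¬circuit-parallel-∅ : ¬ IsCircuit P ∅
    ¬circuit-parallel-∅ circ with circuit-parallel⁻ ∅ ∅ (subst (IsCircuit P) (∅-++ (suc k)) circ)
    ... | circuit₀ circ∅ = IsMatroid.C1 isM circ∅

    module _ (ε₀-nonloop : ¬ IsCircuit M₀ ⁅ ε₀ ⁆) where

      private
        M₀/ε₀ = contract M₀ ε₀

        ∣⊤∣+∣B∣ : ∀ (B : Subset (suc m)) → (∣ ⊤ {suc k} ∣) + ∣ B ∣ ≡ k + suc ∣ B ∣
        ∣⊤∣+∣B∣ B = trans (cong (_+ ∣ B ∣) (∣⊤∣≡n (suc k))) (sym (ℕₚ.+-suc k ∣ B ∣))

      -- A basis J of B ∪ {ε₀} through ε₀, with ε₀ traded for all of 2, …, k+2, is a basis of ⊤ ++ B.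
      rank-parallel-full : ∀ B → rank P (⊤ {suc k} ++ B) ≡ k + rank M₀ (B ∪ ⁅ ε₀ ⁆)
      rank-parallel-full B =
        let J , J⊆ , ε₀∈J , indJ , sizeJ = basis-through isM ε₀-nonloop (x∈p∪⁅x⁆ B ε₀)
            ε₀∉J−ε₀ = λ ε₀∈ → proj₂ (x∈p─⁅y⁆⁻ {p = J} ε₀∈) refl
            indP = independent-parallel-full⁺ ε₀∉J−ε₀ (subst (Independent M₀) (sym (p─⁅x⁆∪⁅x⁆≡p ε₀∈J)) indJ)
            size = trans (∣⊤∣+∣B∣ (J ─ ⁅ ε₀ ⁆)) (cong (_+_ k) (trans (1+∣p─⁅x⁆∣≡∣p∣ ε₀∈J) sizeJ))
        in rank-++ (suc k) P bound ⊆-refl (p⊆q∪⁅x⁆⇒p─⁅x⁆⊆q J⊆) indP size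
        where
        r = k + rank M₀ (B ∪ ⁅ ε₀ ⁆)
        bound : ∀ {C D} → C ⊆ ⊤ → D ⊆ B → Independent P (C ++ D) → ∣ C ∣ + ∣ D ∣ ≤ r
        bound {C} {D} _ D⊆B ind with Vecₚ.≡-dec Data.Bool._≟_ C ⊤
        ... | yes refl =
          let ε₀∉D , indD+ε₀ = independent-parallel-full⁻ ind
          in subst (_≤ r) (sym (trans (∣⊤∣+∣B∣ D) (cong (_+_ k) (sym (∣p∪⁅x⁆∣≡1+∣p∣ ε₀∉D)))))
                   (ℕₚ.+-monoʳ-≤ k (rank-≥ M₀ (p⊆q⇒p∪⁅x⁆⊆q∪⁅x⁆ D⊆B) indD+ε₀))
        ... | no C≢⊤ = ℕₚ.+-mono-≤ (ℕₚ.≤-pred (p≢⊤⇒∣p∣<n C≢⊤))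
            (ℕₚ.≤-trans (rank-≥ M₀ D⊆B (independent-parallel⇒independent₀ ind)) (rank-mono M₀ (p⊆p∪q _)))

      rank-parallel-⊤ : rank P ⊤ ≡ k + rank M₀ ⊤
      rank-parallel-⊤ = begin
        rank P ⊤                        ≡⟨ cong (rank P) (⊤-++ (suc k)) ⟩
        rank P (⊤ {suc k} ++ ⊤)         ≡⟨ rank-parallel-full ⊤ ⟩
        k + rank M₀ (⊤ ∪ ⁅ ε₀ ⁆)        ≡⟨ cong (λ A → k + rank M₀ A) (∪-zeroˡ ⁅ ε₀ ⁆) ⟩
        k + rank M₀ ⊤                   ∎
        where open ≡-Reasoning

      Tutte-parallel : ∀ x y → Tutte P x y ≡ Tutte M₀ x y *ℤ (sumPow x k +ℤ + 1) +ℤ y *ℤ Tutte M₀/ε₀ x y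
      Tutte-parallel x y = trans (sumSubsets-++ (suc k) (tutteTerm P x y))
        (sumSubsets-geometric x k (Tutte M₀ x y) (y *ℤ Tutte M₀/ε₀ x y) _ full-sum proper-sum)
        where
        open ≡-Reasoning
        X = x - + 1
        Y = y - + 1

        proper-term : ∀ {F} B → F ≢ ⊤ →
                      tutteTerm P x y (F ++ B) ≡ tutteMonomial x y k ∣ F ∣ ∣ F ∣ *ℤ tutteTerm M₀ x y B
        proper-term {F} B F≢⊤ = begin
          tutteMonomial x y (rank P ⊤) (rank P (F ++ B)) ∣ F ++ B ∣
            ≡⟨ cong₂ (λ R r → tutteMonomial x y R r ∣ F ++ B ∣) rank-parallel-⊤ (rank-parallel-proper B F≢⊤) ⟩
          tutteMonomial x y (k + rank M₀ ⊤) (∣ F ∣ + rank M₀ B) ∣ F ++ B ∣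
            ≡⟨ cong (tutteMonomial x y (k + rank M₀ ⊤) (∣ F ∣ + rank M₀ B)) (∣++∣ F B) ⟩
          tutteMonomial x y (k + rank M₀ ⊤) (∣ F ∣ + rank M₀ B) (∣ F ∣ + ∣ B ∣)
            ≡⟨ tutteMonomial-+ x y (ℕₚ.≤-pred (p≢⊤⇒∣p∣<n F≢⊤)) ℕₚ.≤-refl (rank-mono M₀ ⊆⊤) (rank≤size M₀ B) ⟩
          tutteMonomial x y k ∣ F ∣ ∣ F ∣ *ℤ tutteTerm M₀ x y B ∎

        proper-sum : ∀ F → F ≢ ⊤ →
                     sumSubsets (suc m) (λ B → tutteTerm P x y (F ++ B)) ≡ Tutte M₀ x y *ℤ X ^ (k ∸ ∣ F ∣)
        proper-sum F F≢⊤ = begin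
          sumSubsets (suc m) (λ B → tutteTerm P x y (F ++ B))
            ≡⟨ sumSubsets-cong (suc m) (λ B → proper-term B F≢⊤) ⟩
          sumSubsets (suc m) (λ B → tutteMonomial x y k ∣ F ∣ ∣ F ∣ *ℤ tutteTerm M₀ x y B)
            ≡⟨ sumSubsets-*ˡ (suc m) (tutteMonomial x y k ∣ F ∣ ∣ F ∣) (tutteTerm M₀ x y) ⟩
          X ^ (k ∸ ∣ F ∣) *ℤ Y ^ (∣ F ∣ ∸ ∣ F ∣) *ℤ Tutte M₀ x y
            ≡⟨ cong (λ e → X ^ (k ∸ ∣ F ∣) *ℤ Y ^ e *ℤ Tutte M₀ x y) (ℕₚ.n∸n≡0 ∣ F ∣) ⟩
          X ^ (k ∸ ∣ F ∣) *ℤ + 1 *ℤ Tutte M₀ x y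
            ≡⟨ reorder (X ^ (k ∸ ∣ F ∣)) (Tutte M₀ x y) ⟩
          Tutte M₀ x y *ℤ X ^ (k ∸ ∣ F ∣) ∎
          where
          reorder : ∀ a t → a *ℤ + 1 *ℤ t ≡ t *ℤ a
          reorder = solve-∀

        full-term : ∀ s b → tutteTerm P x y (⊤ {suc k} ++ insertAt s ε₀ b) ≡
                    tutteMonomial x y (rank M₀/ε₀ ⊤) (rank M₀/ε₀ s) ∣ insertAt s ε₀ b ∣
        full-term s b = begin
          tutteMonomial x y (rank P ⊤) (rank P (⊤ {suc k} ++ Bₛ)) ∣ ⊤ {suc k} ++ Bₛ ∣
            ≡⟨ cong₂ (λ R r → tutteMonomial x y R r ∣ ⊤ {suc k} ++ Bₛ ∣) rank-⊤ rank-B ⟩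
          tutteMonomial x y (k + suc (rank M₀/ε₀ ⊤)) (k + suc (rank M₀/ε₀ s)) ∣ ⊤ {suc k} ++ Bₛ ∣
            ≡⟨ cong (tutteMonomial x y (k + suc (rank M₀/ε₀ ⊤)) (k + suc (rank M₀/ε₀ s)))
                    (trans (∣++∣ (⊤ {suc k}) Bₛ) (∣⊤∣+∣B∣ Bₛ)) ⟩
          tutteMonomial x y (k + suc (rank M₀/ε₀ ⊤)) (k + suc (rank M₀/ε₀ s)) (k + suc ∣ Bₛ ∣)
            ≡⟨ tutteMonomial-cancelˡ x y k ⟩
          tutteMonomial x y (rank M₀/ε₀ ⊤) (rank M₀/ε₀ s) ∣ Bₛ ∣ ∎
          where
          Bₛ = insertAt s ε₀ b
          rank-⊤ : rank P ⊤ ≡ k + suc (rank M₀/ε₀ ⊤)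
          rank-⊤ = begin
            rank P ⊤                             ≡⟨ rank-parallel-⊤ ⟩
            k + rank M₀ ⊤                        ≡⟨ cong (λ A → k + rank M₀ A) (insertAt-⊤ ε₀) ⟨
            k + rank M₀ (insertAt ⊤ ε₀ inside)   ≡⟨ cong (_+_ k) (rank-contract isM ε₀-nonloop ⊤) ⟩
            k + suc (rank M₀/ε₀ ⊤)               ∎
          rank-B : rank P (⊤ {suc k} ++ Bₛ) ≡ k + suc (rank M₀/ε₀ s)
          rank-B = begin
            rank P (⊤ {suc k} ++ Bₛ)              ≡⟨ rank-parallel-full Bₛ ⟩
            k + rank M₀ (Bₛ ∪ ⁅ ε₀ ⁆)             ≡⟨ cong (λ A → k + rank M₀ A) (insertAt-∪⁅⁆ s ε₀ b) ⟩
            k + rank M₀ (insertAt s ε₀ inside)   ≡⟨ cong (_+_ k) (rank-contract isM ε₀-nonloop s) ⟩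
            k + suc (rank M₀/ε₀ s)               ∎

        full-sum : sumSubsets (suc m) (λ B → tutteTerm P x y (⊤ {suc k} ++ B)) ≡ y *ℤ Tutte M₀/ε₀ x y
        full-sum = begin
          sumSubsets (suc m) (λ B → tutteTerm P x y (⊤ {suc k} ++ B))
            ≡⟨ sumSubsets-insertAt ε₀ _ ⟩
          sumSubsets m (λ s → full s outside +ℤ full s inside)
            ≡⟨ sumSubsets-cong m pair ⟩
          sumSubsets m (λ s → y *ℤ tutteTerm M₀/ε₀ x y s)
            ≡⟨ sumSubsets-*ˡ m y (tutteTerm M₀/ε₀ x y) ⟩
          y *ℤ Tutte M₀/ε₀ x y ∎
          where
          full : Subset m → Bool → ℤ
          full s b = tutteTerm P x y (⊤ {suc k} ++ insertAt s ε₀ b)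
          pair : ∀ s → full s outside +ℤ full s inside ≡ y *ℤ tutteTerm M₀/ε₀ x y s
          pair s = begin
            full s outside +ℤ full s inside
              ≡⟨ cong₂ _+ℤ_ (full-term s outside) (full-term s inside) ⟩
            X ^ a *ℤ Y ^ (∣ insertAt s ε₀ outside ∣ ∸ r) +ℤ X ^ a *ℤ Y ^ (∣ insertAt s ε₀ inside ∣ ∸ r)
              ≡⟨ cong₂ (λ u v → X ^ a *ℤ Y ^ (u ∸ r) +ℤ X ^ a *ℤ Y ^ v) (∣insertAt-outside∣ s ε₀)
                       (trans (cong (_∸ r) (∣insertAt-inside∣ s ε₀)) (ℕₚ.+-∸-assoc 1 (rank≤size M₀/ε₀ s))) ⟩
            X ^ a *ℤ Y ^ (∣ s ∣ ∸ r) +ℤ X ^ a *ℤ (Y *ℤ Y ^ (∣ s ∣ ∸ r))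
              ≡⟨ factor y (X ^ a) (Y ^ (∣ s ∣ ∸ r)) ⟩
            y *ℤ tutteTerm M₀/ε₀ x y s ∎
            where
            a = rank M₀/ε₀ ⊤ ∸ rank M₀/ε₀ s
            r = rank M₀/ε₀ s
            factor : ∀ y p q → p *ℤ q +ℤ p *ℤ ((y - + 1) *ℤ q) ≡ y *ℤ (p *ℤ q)
            factor = solve-∀

theorem4p4 : (k m : ℕ) (M0 : Matroid (suc m)) → IsMatroid M0 → Simple M0 →
    (ε0 : Fin (suc m)) → (x y : ℤ) →
      (Tutte (Cyc (suc (suc k)) ⊕ M0) x y
         ≡ (sumPow x (suc k) +ℤ y) *ℤ Tutte M0 x y)
    × (Tutte (parallel (Cyc (suc (suc k))) zero M0 ε0 ⊕ Spt) x y
         ≡ (sumPow x (suc k) *ℤ Tutte M0 x y) +ℤ ((x *ℤ y) *ℤ Tutte (contract M0 ε0) x y))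
theorem4p4 k m M0 isM simple ε0 x y = Tutte-C⊕M0 , Tutte-P⊕S
  where
  open ≡-Reasoning
  open ParallelConnection k M0 ε0 using (P; ¬circuit-parallel-∅; Tutte-parallel)
  T0 = Tutte M0 x y
  Tc = Tutte (contract M0 ε0) x y

  Tutte-C⊕M0 : Tutte (Cyc (suc (suc k)) ⊕ M0) x y ≡ (sumPow x (suc k) +ℤ y) *ℤ T0
  Tutte-C⊕M0 = begin
    Tutte (Cyc (suc (suc k)) ⊕ M0) x y
      ≡⟨ Tutte-⊕ (Cyc (suc (suc k))) M0 (¬circuit-Cyc-∅ (suc k)) (IsMatroid.C1 isM) x y ⟩
    Tutte (Cyc (suc (suc k))) x y *ℤ T0
      ≡⟨ cong (_*ℤ T0) (Tutte-Cyc (suc k) x y) ⟩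
    (sumPow x (suc k) +ℤ y) *ℤ T0 ∎

  Tutte-P⊕S : Tutte (P ⊕ Spt) x y ≡ (sumPow x (suc k) *ℤ T0) +ℤ ((x *ℤ y) *ℤ Tc)
  Tutte-P⊕S = begin
    Tutte (P ⊕ Spt) x y
      ≡⟨ Tutte-⊕ P Spt (¬circuit-parallel-∅ isM) (λ ()) x y ⟩
    Tutte P x y *ℤ Tutte Spt x y
      ≡⟨ cong₂ _*ℤ_ (Tutte-parallel isM (simple⇒nonloop simple) x y) (Tutte-Spt x y) ⟩
    (T0 *ℤ (sumPow x k +ℤ + 1) +ℤ y *ℤ Tc) *ℤ x
      ≡⟨ rearrange T0 (sumPow x k) y Tc x ⟩
    (x *ℤ (sumPow x k +ℤ + 1)) *ℤ T0 +ℤ (x *ℤ y) *ℤ Tc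
      ≡⟨ cong (λ s → s *ℤ T0 +ℤ (x *ℤ y) *ℤ Tc) (sumPow-suc-factor x k) ⟨
    sumPow x (suc k) *ℤ T0 +ℤ (x *ℤ y) *ℤ Tc ∎
    where
    rearrange : ∀ t s y c x → (t *ℤ (s +ℤ + 1) +ℤ y *ℤ c) *ℤ x ≡ (x *ℤ (s +ℤ + 1)) *ℤ t +ℤ (x *ℤ y) *ℤ c
    rearrange = solve-∀
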